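{- Let $\psi\in\mathrm{FO}(\sim,\prec)$ be a sentence of quantifier rank $k$ and let $\Gamma=\{a_1,\dots,a_\ell\}$ be the set of unary predicates used in $\psi$. There exists a finite automaton $C$ over the alphabet $\Gamma\cup(2^\Gamma\times\mathcal{F}_{\Gamma,k})$ such that: (i) $C$ accepts only words of the form $a_1^{f_1(a_1)}\cdots a_\ell^{f_1(a_\ell)}(S_1,f_1)\cdots a_1^{f_m(a_1)}\cdots a_\ell^{f_m(a_\ell)}(S_m,f_m)$ where each $S_i=\{a\mid f_i(a)\ge1\}$; (ii) for every ordered-data tree $t$ over $\Gamma$ with $t\models\psi$, if $\mathcal{V}^k_\Gamma(t)=(S_1,f_1)\cdots(S_m,f_m)$ then $C$ accepts the word $a_1^{f_1(a_1)}\cdots a_\ell^{f_1(a_\ell)}(S_1,f_1)\cdots a_1^{f_m(a_1)}\cdots a_\ell^{f_m(a_\ell)}(S_m,f_m)$; (iii) for every word accepted by $C$, of the form $a_1^{f_1(a_1)}\cdots a_\ell^{f_1(a_\ell)}(S_1,f_1)\cdots a_1^{f_m(a_1)}\cdots a_\ell^{f_m(a_\ell)}(S_m,f_m)$, there exists an ordered-data tree $t$ over $\Gamma$ with $t\models\psi$ and $\mathcal{V}^k_\Gamma(t)=(S_1,f_1)\cdots(S_m,f_m)$.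
   Context: Ordered-data trees over $\Gamma$: finite unranked ordered trees whose nodes carry a label in $\Gamma$ and a data value in $\mathbb{N}$; in this setting it is assumed that the data values of any tree are exactly $1,\dots,m$ for some $m\ge1$. Relations: label predicates, $x\sim y$ iff equal data values, $x\prec y$ iff smaller data value. $\mathcal{F}_{\Gamma,k}$ is the set of functions $f:\Gamma\to\{0,1,\dots,k\}$; $f$ is a $k$-characteristic function for $S$ if $f(a)\in\{1,\dots,k\}$ for $a\in S$ and $f(a)=0$ otherwise. With $V(a)$ the set of data values of $a$-nodes and $[S]=\bigcap_{a\in S}V(a)\cap\bigcap_{b\notin S}\overline{V(b)}$, if $d_1<\dots<d_m$ are the data values of $t$, the $k$-extended representation $\mathcal{V}^k_\Gamma(t)$ is $(S_1,f_1)\cdots(S_m,f_m)$ where $d_i\in[S_i]$, $f_i$ is a $k$-characteristic function for $S_i$, and for each $a$: if $1\le f_i(a)\le k-1$ there are exactly $f_i(a)$ $a$-nodes with value $d_i$, and if $f_i(a)=k$ at least $k$. $a^n$ denotes $n$ repetitions of letter $a$. -}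

module Defs where

open import Data.Nat using (ℕ; zero; suc; _≤_; _<_; _∸_)
open import Data.Fin using (Fin; toℕ)
open import Data.Fin.Subset using (Subset; _∈_; _∉_)
open import Data.List using (List; []; _∷_; _++_; length; lookup; replicate; concatMap; allFin; foldl)
open import Data.List.Membership.Propositional using () renaming (_∈_ to _∈ᴸ_)
open import Data.Product using (Σ; ∃; _×_; _,_; proj₁; proj₂)
open import Data.Sum using (_⊎_; inj₁; inj₂)
open import Data.Bool using (Bool; true; false; if_then_else_; _∧_)
open import Relation.Nullary using (¬_; does)
open import Relation.Binary.PropositionalEquality using (_≡_)
import Data.Fin as F
import Data.Nat as N

data Tree (ℓ : ℕ) : Set where
  node : Fin ℓ → ℕ → List (Tree ℓ) → Tree ℓ

Node : ℕ → Set
Node ℓ = Fin ℓ × ℕ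

mutual
  -- the nodes of a tree, in preorder; a node is identified by its position
  nodes : ∀ {ℓ} → Tree ℓ → List (Node ℓ)
  nodes (node a d ts) = (a , d) ∷ nodesF ts

  nodesF : ∀ {ℓ} → List (Tree ℓ) → List (Node ℓ)
  nodesF []       = []
  nodesF (t ∷ ts) = nodes t ++ nodesF ts

DataValuesExactly : ∀ {ℓ} → Tree ℓ → ℕ → Set
DataValuesExactly t m =
  (∀ (a : Fin _) (d : ℕ) → (a , d) ∈ᴸ nodes t → 1 ≤ d × d ≤ m)
  × (∀ d → 1 ≤ d → d ≤ m → ∃ λ a → (a , d) ∈ᴸ nodes t)

OrderedDataTree : ∀ {ℓ} → Tree ℓ → Set
OrderedDataTree t = Σ ℕ λ m → 1 ≤ m × DataValuesExactly t m

data Formula (ℓ : ℕ) : ℕ → Set where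
  lab  : ∀ {n} → Fin ℓ → Fin n → Formula ℓ n
  eq   : ∀ {n} → Fin n → Fin n → Formula ℓ n
  sim  : ∀ {n} → Fin n → Fin n → Formula ℓ n
  prec : ∀ {n} → Fin n → Fin n → Formula ℓ n
  neg  : ∀ {n} → Formula ℓ n → Formula ℓ n
  and  : ∀ {n} → Formula ℓ n → Formula ℓ n → Formula ℓ n
  or   : ∀ {n} → Formula ℓ n → Formula ℓ n → Formula ℓ n
  ex   : ∀ {n} → Formula ℓ (suc n) → Formula ℓ n
  all  : ∀ {n} → Formula ℓ (suc n) → Formula ℓ n

Sentence : ℕ → Set
Sentence ℓ = Formula ℓ 0

qr : ∀ {ℓ n} → Formula ℓ n → ℕ
qr (lab _ _)  = 0
qr (eq _ _)   = 0
qr (sim _ _)  = 0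
qr (prec _ _) = 0
qr (neg φ)    = qr φ
qr (and φ ψ)  = qr φ N.⊔ qr ψ
qr (or φ ψ)   = qr φ N.⊔ qr ψ
qr (ex φ)     = suc (qr φ)
qr (all φ)    = suc (qr φ)

data Occurs {ℓ : ℕ} (a : Fin ℓ) : ∀ {n} → Formula ℓ n → Set where
  here  : ∀ {n} (x : Fin n) → Occurs a (lab a x)
  neg   : ∀ {n} {φ : Formula ℓ n} → Occurs a φ → Occurs a (neg φ)
  andˡ  : ∀ {n} {φ ψ : Formula ℓ n} → Occurs a φ → Occurs a (and φ ψ)
  andʳ  : ∀ {n} {φ ψ : Formula ℓ n} → Occurs a ψ → Occurs a (and φ ψ)
  orˡ   : ∀ {n} {φ ψ : Formula ℓ n} → Occurs a φ → Occurs a (or φ ψ)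
  orʳ   : ∀ {n} {φ ψ : Formula ℓ n} → Occurs a ψ → Occurs a (or φ ψ)
  ex    : ∀ {n} {φ : Formula ℓ (suc n)} → Occurs a φ → Occurs a (ex φ)
  all   : ∀ {n} {φ : Formula ℓ (suc n)} → Occurs a φ → Occurs a (all φ)

extend : ∀ {A : Set} {n} → A → (Fin n → A) → Fin (suc n) → A
extend v ρ F.zero    = v
extend v ρ (F.suc i) = ρ i

-- satisfaction in a list of nodes; variables denote node positions
Sat : ∀ {ℓ n} (ns : List (Node ℓ)) → Formula ℓ n → (Fin n → Fin (length ns)) → Set
Sat ns (lab a x)  ρ = proj₁ (lookup ns (ρ x)) ≡ a
Sat ns (eq x y)   ρ = ρ x ≡ ρ y
Sat ns (sim x y)  ρ = proj₂ (lookup ns (ρ x)) ≡ proj₂ (lookup ns (ρ y))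
Sat ns (prec x y) ρ = proj₂ (lookup ns (ρ x)) < proj₂ (lookup ns (ρ y))
Sat ns (neg φ)    ρ = ¬ Sat ns φ ρ
Sat ns (and φ ψ)  ρ = Sat ns φ ρ × Sat ns ψ ρ
Sat ns (or φ ψ)   ρ = Sat ns φ ρ ⊎ Sat ns ψ ρ
Sat ns (ex φ)     ρ = Σ (Fin (length ns)) λ v → Sat ns φ (extend v ρ)
Sat ns (all φ)    ρ = (v : Fin (length ns)) → Sat ns φ (extend v ρ)

_⊨_ : ∀ {ℓ} → Tree ℓ → Sentence ℓ → Set
t ⊨ ψ = Sat (nodes t) ψ (λ ())

FunGK : ℕ → ℕ → Set
FunGK ℓ k = Fin ℓ → Fin (suc k)

_∈V_ : ∀ {ℓ} → ℕ → Fin ℓ × Tree ℓ → Set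
d ∈V (a , t) = (a , d) ∈ᴸ nodes t

InClass : ∀ {ℓ} → Tree ℓ → ℕ → Subset ℓ → Set
InClass t d S = (∀ a → a ∈ S → d ∈V (a , t)) × (∀ b → b ∉ S → ¬ (d ∈V (b , t)))

IsCharFun : ∀ {ℓ} (k : ℕ) → FunGK ℓ k → Subset ℓ → Set
IsCharFun k f S = ∀ a → (a ∈ S → 1 ≤ toℕ (f a)) × (a ∉ S → toℕ (f a) ≡ 0)

count : ∀ {ℓ} → Fin ℓ → ℕ → List (Node ℓ) → ℕ
count a d []             = 0
count a d ((b , e) ∷ xs) =
  if does (a F.≟ b) ∧ does (d N.≟ e) then suc (count a d xs) else count a d xs

CountOK : ∀ {ℓ} (k : ℕ) → Tree ℓ → ℕ → FunGK ℓ k → Set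
CountOK k t d f = ∀ a →
  (1 ≤ toℕ (f a) → toℕ (f a) ≤ k ∸ 1 → count a d (nodes t) ≡ toℕ (f a))
  × (toℕ (f a) ≡ k → k ≤ count a d (nodes t))

-- w = V^k_Γ(t) (data values of t are 1,…,m, so d_i = i)
IsExtRep : ∀ {ℓ} (k : ℕ) → Tree ℓ → List (Subset ℓ × FunGK ℓ k) → Set
IsExtRep k t w =
  DataValuesExactly t (length w)
  × (∀ (i : Fin (length w)) →
       let d = suc (toℕ i) ; S = proj₁ (lookup w i) ; f = proj₂ (lookup w i) in
       InClass t d S × IsCharFun k f S × CountOK k t d f)

Letter : ℕ → ℕ → Set
Letter ℓ k = Fin ℓ ⊎ (Subset ℓ × FunGK ℓ k)

block : ∀ {ℓ k} → Subset ℓ × FunGK ℓ k → List (Letter ℓ k)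
block {ℓ} (S , f) =
  concatMap (λ j → replicate (toℕ (f j)) (inj₁ j)) (allFin ℓ) ++ (inj₂ (S , f) ∷ [])

encode : ∀ {ℓ k} → List (Subset ℓ × FunGK ℓ k) → List (Letter ℓ k)
encode = concatMap block

WellFormedLetter : ∀ {ℓ k} → Subset ℓ × FunGK ℓ k → Set
WellFormedLetter (S , f) = ∀ a → (a ∈ S → 1 ≤ toℕ (f a)) × (1 ≤ toℕ (f a) → a ∈ S)

WellFormed : ∀ {ℓ k} → List (Subset ℓ × FunGK ℓ k) → Set
WellFormed w = ∀ i → WellFormedLetter (lookup w i)

record DFA (A : Set) : Set where
  field
    nStates : ℕ
    init    : Fin nStates
    δ       : Fin nStates → A → Fin nStates
    final   : Fin nStates → Bool

Accepts : ∀ {A} → DFA A → List A → Set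
Accepts C u = DFA.final C (foldl (DFA.δ C) (DFA.init C) u) ≡ true

module Submission where

-- FO(∼,≺) has no tree relations, so a data tree is seen by ψ only as the multiset of its
-- (label, data value) nodes, with data values compared by = and <. An Ehrenfeucht–Fraïssé
-- argument shows that sentences of quantifier rank k cannot distinguish two such multisets in
-- which every node occurs equally often or at least k times in both; hence t ⊨ ψ iff the
-- canonical model of its k-extended representation (f_i(a) copies of (a, i) for each i) does.
-- The automaton computes the rank-k Hintikka type of this canonical model block by block:
-- the type of xs ++ ys, when all values of xs lie below those of ys, is determined by the types
-- of xs and ys (Feferman–Vaught), the type of a block does not depend on its common data value,
-- and there are finitely many types. The label letters before each profile letter are held in a
-- buffer of length at most ℓ k and compared with the profile.

open import Defs
open import Data.Nat using (ℕ)
open import Data.List using (List)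
open import Data.Product using (Σ; ∃; _×_)
open import Relation.Binary.PropositionalEquality using (_≡_)

open import Data.Bool as B using (Bool; true; false; T; not; _∧_; _∨_)
open import Data.Bool.Properties using (T-∧; T-∨; T-≡)
open import Data.Empty using (⊥; ⊥-elim)
open import Data.Fin as F using (Fin; toℕ)
import Data.Fin.Properties as F
open import Data.Fin.Subset using (Subset; _∈_)
import Data.Fin.Subset.Properties as Subset
open import Data.List as L using ([]; _∷_; _++_; [_]; length; allFin; replicate; concatMap; foldl; cartesianProduct)
import Data.List.Properties as L
open import Data.List.Membership.Propositional using (lose) renaming (_∈_ to _∈ᴸ_; _∉_ to _∉ᴸ_)
open import Data.List.Membership.Propositional.Properties using (∈-allFin; ∈-cartesianProduct⁺; ∈-map⁺; ∈-lookup)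
open import Data.List.Relation.Unary.All as All using (All; []; _∷_)
import Data.List.Relation.Unary.All.Properties as All
open import Data.List.Relation.Unary.AllPairs using ([]; _∷_)
open import Data.List.Relation.Unary.Any as Any using (here; there; satisfied)
open import Data.List.Relation.Unary.Any.Properties using (lookup-index)
open import Data.List.Relation.Unary.Unique.Propositional using (Unique)
open import Data.List.Relation.Unary.Unique.Propositional.Properties using (allFin⁺)
open import Data.Maybe using (Maybe; just; nothing)
import Data.Maybe.Properties as Maybe
open import Data.Nat as N using (zero; suc; _≤_; _<_; _+_; _*_; s≤s; z≤n; _≤?_; _<?_)
import Data.Nat.Properties as N
open import Data.Product using (_,_; proj₁; proj₂; map₂)
import Data.Product.Properties as ×
open import Data.Product.Function.NonDependent.Propositional using (_×-⇔_)
open import Data.Sum as Sum using (_⊎_; inj₁; inj₂)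
open import Data.Sum.Function.Propositional using (_⊎-⇔_)
open import Data.Unit using (⊤; tt)
open import Data.Vec as V using (Vec)
import Data.Vec.Properties as V
open import Function using (_∘_; _⇔_; mk⇔; Equivalence; const)
open import Function.Construct.Composition using (_⇔-∘_)
open import Level using (0ℓ)
open import Relation.Binary using (DecidableEquality)
open import Relation.Binary.PropositionalEquality using (_≢_; refl; sym; trans; cong; cong₂; subst; subst₂; _≗_; module ≡-Reasoning)
open import Relation.Nullary using (¬_; Dec; yes; no; does; map′)
open import Relation.Nullary.Decidable using (_×-dec_; _⊎-dec_; _→-dec_; T?; does-⇔; dec-true; dec-false; decidable-stable)
open import Relation.Unary using (Pred; Decidable)

open Equivalence using (to; from)

record Finite (A : Set) : Set where
  field
    decEq    : DecidableEquality A
    elements : List A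
    complete : ∀ a → a ∈ᴸ elements
open Finite

Bool-finite : Finite Bool
Bool-finite = record
  { decEq = B._≟_ ; elements = true ∷ false ∷ []
  ; complete = λ { true → here refl ; false → there (here refl) } }

Fin-finite : ∀ n → Finite (Fin n)
Fin-finite n = record { decEq = F._≟_ ; elements = allFin n ; complete = ∈-allFin }

×-finite : ∀ {A B} → Finite A → Finite B → Finite (A × B)
×-finite FA FB = record
  { decEq    = ×.≡-dec (decEq FA) (decEq FB)
  ; elements = cartesianProduct (elements FA) (elements FB)
  ; complete = λ (a , b) → ∈-cartesianProduct⁺ (complete FA a) (complete FB b) }

vectors : ∀ {A : Set} → List A → ∀ n → List (Vec A n)
vectors xs zero    = V.[] ∷ []
vectors xs (suc n) = L.map (λ (x , v) → x V.∷ v) (cartesianProduct xs (vectors xs n))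

∈-vectors : ∀ {A} {xs : List A} → (∀ a → a ∈ᴸ xs) → ∀ {n} (v : Vec A n) → v ∈ᴸ vectors xs n
∈-vectors xs-complete V.[]       = here refl
∈-vectors xs-complete (a V.∷ v) = ∈-map⁺ _ (∈-cartesianProduct⁺ (xs-complete a) (∈-vectors xs-complete v))

Vec-finite : ∀ {A} → Finite A → ∀ n → Finite (Vec A n)
Vec-finite FA n = record
  { decEq = V.≡-dec (decEq FA) ; elements = vectors (elements FA) n
  ; complete = ∈-vectors (complete FA) }

PowerSet : ∀ {A} → Finite A → Set
PowerSet FA = Vec Bool (length (elements FA))

PowerSet-finite : ∀ {A} (FA : Finite A) → Finite (PowerSet FA)
PowerSet-finite FA = Vec-finite Bool-finite _

member : ∀ {A} (FA : Finite A) → PowerSet FA → A → Bool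
member FA S a = V.lookup S (Any.index (complete FA a))

fromPred : ∀ {A} (FA : Finite A) → (A → Bool) → PowerSet FA
fromPred FA P = V.tabulate (P ∘ L.lookup (elements FA))

member-fromPred : ∀ {A} (FA : Finite A) (P : A → Bool) a → member FA (fromPred FA P) a ≡ P a
member-fromPred FA P a =
  trans (V.lookup∘tabulate _ (Any.index (complete FA a))) (cong P (sym (lookup-index (complete FA a))))

fromPred-cong : ∀ {A} (FA : Finite A) {P Q : A → Bool} → P ≗ Q → fromPred FA P ≡ fromPred FA Q
fromPred-cong FA P≗Q = V.tabulate-cong (P≗Q ∘ L.lookup (elements FA))

∃? : ∀ {A} {P : Pred A 0ℓ} (FA : Finite A) → Decidable P → Dec (∃ P)
∃? FA P? = map′ satisfied (λ (a , p) → lose (complete FA a) p) (Any.any? P? (elements FA))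

∀? : ∀ {A} {P : Pred A 0ℓ} (FA : Finite A) → Decidable P → Dec (∀ a → P a)
∀? FA P? = map′ (λ ps a → All.lookup ps (complete FA a)) (λ f → All.tabulate (λ {a} _ → f a))
                (All.all? P? (elements FA))

T-does : ∀ {P : Set} (P? : Dec P) → T (does P?) ⇔ P
T-does (yes p) = mk⇔ (λ _ → p) (λ _ → _)
T-does (no ¬p) = mk⇔ (λ ()) ¬p

boundedLists : ∀ {A} → Finite A → ℕ → List (List A)
boundedLists FA zero    = [] ∷ []
boundedLists FA (suc n) = [] ∷ L.map (λ (a , as) → a ∷ as) (cartesianProduct (elements FA) (boundedLists FA n))

∈-boundedLists : ∀ {A} (FA : Finite A) {n} (as : List A) → length as ≤ n → as ∈ᴸ boundedLists FA n
∈-boundedLists FA {zero}  []       _         = here refl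
∈-boundedLists FA {suc n} []       _         = here refl
∈-boundedLists FA {suc n} (a ∷ as) (s≤s len) =
  there (∈-map⁺ _ (∈-cartesianProduct⁺ (complete FA a) (∈-boundedLists FA as len)))

T-not : ∀ b → T (not b) ⇔ (¬ T b)
T-not true  = mk⇔ (λ ()) (λ ¬t → ¬t _)
T-not false = mk⇔ (λ _ ()) (λ _ → _)

¬-⇔ : ∀ {A B : Set} → A ⇔ B → (¬ A) ⇔ (¬ B)
¬-⇔ A⇔B = mk⇔ (λ ¬a b → ¬a (from A⇔B b)) (λ ¬b a → ¬b (to A⇔B a))

extend-cong : ∀ {A : Set} {n} (v : A) {ρ ρ' : Fin n → A} → ρ ≗ ρ' → extend v ρ ≗ extend v ρ'
extend-cong v ρ≗ρ' F.zero    = refl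
extend-cong v ρ≗ρ' (F.suc x) = ρ≗ρ' x

module HintikkaTypes (ℓ : ℕ) where

  Structure : Set
  Structure = List (Node ℓ)

  label : (ns : Structure) → Fin (length ns) → Fin ℓ
  label ns i = proj₁ (L.lookup ns i)

  value : (ns : Structure) → Fin (length ns) → ℕ
  value ns i = proj₂ (L.lookup ns i)

  Cell : Set
  Cell = Bool × Bool × Bool

  Cell-finite : Finite Cell
  Cell-finite = ×-finite Bool-finite (×-finite Bool-finite Bool-finite)

  cell : (ns : Structure) → Fin (length ns) → Fin (length ns) → Cell
  cell ns i j = does (i F.≟ j) , does (value ns i N.≟ value ns j) , does (value ns i <? value ns j)

  -- The second component of a rank-(r+1) type is the set of rank-r types of the one-point extensions.
  mutual
    Type : ℕ → ℕ → Set
    Type zero    n = Vec (Fin ℓ × Vec Cell n) n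
    Type (suc r) n = Type r n × PowerSet (Type-finite r (suc n))

    Type-finite : ∀ r n → Finite (Type r n)
    Type-finite zero    n = Vec-finite (×-finite (Fin-finite ℓ) (Vec-finite Cell-finite n)) n
    Type-finite (suc r) n = ×-finite (Type-finite r n) (PowerSet-finite (Type-finite r (suc n)))

  Realises : ∀ r {n} (ns : Structure) → (Fin n → Fin (length ns)) → Type r (suc n) → Set
  type : ∀ r {n} (ns : Structure) → (Fin n → Fin (length ns)) → Type r n
  realises? : ∀ r {n} ns ρ (τ : Type r (suc n)) → Dec (Realises r ns ρ τ)

  Realises r ns ρ τ = ∃ λ v → type r ns (extend v ρ) ≡ τ

  type zero        ns ρ = V.tabulate λ x → label ns (ρ x) , V.tabulate λ y → cell ns (ρ x) (ρ y)
  type (suc r) {n} ns ρ = type r ns ρ , fromPred (Type-finite r (suc n)) (does ∘ realises? r ns ρ)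

  realises? r {n} ns ρ τ = F.any? λ v → decEq (Type-finite r (suc n)) (type r ns (extend v ρ)) τ

  Extends : ∀ r {n} → Type (suc r) n → Type r (suc n) → Set
  Extends r {n} τ σ = T (member (Type-finite r (suc n)) (proj₂ τ) σ)

  extends? : ∀ r {n} (τ : Type (suc r) n) σ → Dec (Extends r τ σ)
  extends? r {n} τ σ = T? (member (Type-finite r (suc n)) (proj₂ τ) σ)

  someExtension? : ∀ r {n} (τ : Type (suc r) n) (P : Type r (suc n) → Bool) →
                   Dec (∃ λ σ → Extends r τ σ × T (P σ))
  someExtension? r {n} τ P = ∃? (Type-finite r (suc n)) λ σ → extends? r τ σ ×-dec T? (P σ)

  everyExtension? : ∀ r {n} (τ : Type (suc r) n) (P : Type r (suc n) → Bool) →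
                    Dec (∀ σ → Extends r τ σ → T (P σ))
  everyExtension? r {n} τ P = ∀? (Type-finite r (suc n)) λ σ → extends? r τ σ →-dec T? (P σ)

  Extends-type : ∀ r {n} ns ρ (σ : Type r (suc n)) → Extends r (type (suc r) ns ρ) σ ⇔ Realises r ns ρ σ
  Extends-type r {n} ns ρ σ =
    subst (λ b → T b ⇔ Realises r ns ρ σ) (sym (member-fromPred (Type-finite r (suc n)) _ σ)) (T-does (realises? r ns ρ σ))

  type-cong : ∀ r {n} ns {ρ ρ' : Fin n → Fin (length ns)} → ρ ≗ ρ' → type r ns ρ ≡ type r ns ρ'
  type-cong zero    ns ρ≗ρ' = V.tabulate-cong λ x →
    cong₂ _,_ (cong (label ns) (ρ≗ρ' x)) (V.tabulate-cong λ y → cong₂ (cell ns) (ρ≗ρ' x) (ρ≗ρ' y))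
  type-cong (suc r) {n} ns {ρ} {ρ'} ρ≗ρ' = cong₂ _,_ (type-cong r ns ρ≗ρ') (fromPred-cong (Type-finite r (suc n)) λ τ →
    does-⇔ (mk⇔ (transport ρ≗ρ') (transport (sym ∘ ρ≗ρ'))) (realises? r ns ρ τ) (realises? r ns ρ' τ))
    where
    transport : ∀ {σ σ'} → σ ≗ σ' → ∀ {τ} → Realises r ns σ τ → Realises r ns σ' τ
    transport σ≗σ' (v , e) = v , trans (type-cong r ns (extend-cong v (sym ∘ σ≗σ'))) e

  atomic : ∀ r {n} → Type r n → Type zero n
  atomic zero    τ = τ
  atomic (suc r) τ = atomic r (proj₁ τ)

  atomic-type : ∀ r {n} ns (ρ : Fin n → Fin (length ns)) → atomic r (type r ns ρ) ≡ type zero ns ρ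
  atomic-type zero    ns ρ = refl
  atomic-type (suc r) ns ρ = atomic-type r ns ρ

  labelOf : ∀ {n} → Type zero n → Fin n → Fin ℓ
  labelOf τ x = proj₁ (V.lookup τ x)

  cellOf : ∀ {n} → Type zero n → Fin n → Fin n → Cell
  cellOf τ x y = V.lookup (proj₂ (V.lookup τ x)) y

  labelOf-type : ∀ r {n} ns (ρ : Fin n → Fin (length ns)) x → labelOf (atomic r (type r ns ρ)) x ≡ label ns (ρ x)
  labelOf-type r ns ρ x rewrite atomic-type r ns ρ = cong proj₁ (V.lookup∘tabulate _ x)

  cellOf-type : ∀ r {n} ns (ρ : Fin n → Fin (length ns)) x y →
                cellOf (atomic r (type r ns ρ)) x y ≡ cell ns (ρ x) (ρ y)
  cellOf-type r ns ρ x y rewrite atomic-type r ns ρ =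
    trans (cong (λ c → V.lookup (proj₂ c) y) (V.lookup∘tabulate _ x)) (V.lookup∘tabulate _ y)

  eval : ∀ {n} (φ : Formula ℓ n) r → qr φ ≤ r → Type r n → Bool
  eval (lab a x)  r _ τ = does (labelOf (atomic r τ) x F.≟ a)
  eval (eq x y)   r _ τ = proj₁ (cellOf (atomic r τ) x y)
  eval (sim x y)  r _ τ = proj₁ (proj₂ (cellOf (atomic r τ) x y))
  eval (prec x y) r _ τ = proj₂ (proj₂ (cellOf (atomic r τ) x y))
  eval (neg φ)    r h τ = not (eval φ r h τ)
  eval (and φ ψ)  r h τ = eval φ r (N.m⊔n≤o⇒m≤o _ _ h) τ ∧ eval ψ r (N.m⊔n≤o⇒n≤o _ _ h) τ
  eval (or φ ψ)   r h τ = eval φ r (N.m⊔n≤o⇒m≤o _ _ h) τ ∨ eval ψ r (N.m⊔n≤o⇒n≤o _ _ h) τ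
  eval (ex φ)  (suc r) (s≤s h) τ = does (someExtension? r τ (eval φ r h))
  eval (all φ) (suc r) (s≤s h) τ = does (everyExtension? r τ (eval φ r h))

  eval-type : ∀ {n} (φ : Formula ℓ n) r (h : qr φ ≤ r) ns (ρ : Fin n → Fin (length ns)) →
              T (eval φ r h (type r ns ρ)) ⇔ Sat ns φ ρ
  eval-type (lab a x)  r h ns ρ rewrite labelOf-type r ns ρ x   = T-does (label ns (ρ x) F.≟ a)
  eval-type (eq x y)   r h ns ρ rewrite cellOf-type r ns ρ x y = T-does (ρ x F.≟ ρ y)
  eval-type (sim x y)  r h ns ρ rewrite cellOf-type r ns ρ x y = T-does (value ns (ρ x) N.≟ value ns (ρ y))
  eval-type (prec x y) r h ns ρ rewrite cellOf-type r ns ρ x y = T-does (value ns (ρ x) <? value ns (ρ y))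
  eval-type (neg φ)    r h ns ρ = ¬-⇔ (eval-type φ r h ns ρ) ⇔-∘ T-not _
  eval-type (and φ ψ)  r h ns ρ = (eval-type φ r _ ns ρ ×-⇔ eval-type ψ r _ ns ρ) ⇔-∘ T-∧
  eval-type (or φ ψ)   r h ns ρ = (eval-type φ r _ ns ρ ⊎-⇔ eval-type ψ r _ ns ρ) ⇔-∘ T-∨
  eval-type (ex φ) (suc r) (s≤s h) ns ρ =
    mk⇔ witness realise ⇔-∘ T-does (someExtension? r (type (suc r) ns ρ) (eval φ r h))
    where
    witness : (∃ λ σ → Extends r (type (suc r) ns ρ) σ × T (eval φ r h σ)) → Sat ns (ex φ) ρ
    witness (σ , m , e) with to (Extends-type r ns ρ σ) m
    ... | v , refl = v , to (eval-type φ r h ns (extend v ρ)) e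
    realise : Sat ns (ex φ) ρ → ∃ λ σ → Extends r (type (suc r) ns ρ) σ × T (eval φ r h σ)
    realise (v , s) = type r ns (extend v ρ) , from (Extends-type r ns ρ _) (v , refl)
                    , from (eval-type φ r h ns (extend v ρ)) s
  eval-type (all φ) (suc r) (s≤s h) ns ρ =
    mk⇔ instantiate generalise ⇔-∘ T-does (everyExtension? r (type (suc r) ns ρ) (eval φ r h))
    where
    instantiate : (∀ σ → Extends r (type (suc r) ns ρ) σ → T (eval φ r h σ)) → Sat ns (all φ) ρ
    instantiate f v = to (eval-type φ r h ns (extend v ρ)) (f _ (from (Extends-type r ns ρ _) (v , refl)))
    generalise : Sat ns (all φ) ρ → ∀ σ → Extends r (type (suc r) ns ρ) σ → T (eval φ r h σ)
    generalise s σ m with to (Extends-type r ns ρ σ) m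
    ... | v , refl = from (eval-type φ r h ns (extend v ρ)) (s v)

module IsomorphismInvariance (ℓ : ℕ) where
  open HintikkaTypes ℓ

  record Isomorphism (ns ns' : Structure) : Set where
    field
      pos           : Fin (length ns) → Fin (length ns')
      pos-injective : ∀ {i j} → pos i ≡ pos j → i ≡ j
      pos-onto      : ∀ v → ∃ λ u → pos u ≡ v
      pos-label     : ∀ i → label ns' (pos i) ≡ label ns i
      pos-∼         : ∀ i j → value ns' (pos i) ≡ value ns' (pos j) ⇔ value ns i ≡ value ns j
      pos-≺         : ∀ i j → value ns' (pos i) < value ns' (pos j) ⇔ value ns i < value ns j

  module _ {ns ns'} (ι : Isomorphism ns ns') where
    open Isomorphism ι

    pos-cell : ∀ i j → cell ns' (pos i) (pos j) ≡ cell ns i j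
    pos-cell i j = cong₂ _,_ (does-⇔ (mk⇔ pos-injective (cong pos)) (pos i F.≟ pos j) (i F.≟ j))
      (cong₂ _,_ (does-⇔ (pos-∼ i j) (value ns' (pos i) N.≟ value ns' (pos j)) (value ns i N.≟ value ns j))
                 (does-⇔ (pos-≺ i j) (value ns' (pos i) <? value ns' (pos j)) (value ns i <? value ns j)))

    type-iso : ∀ r {n} (ρ : Fin n → Fin (length ns)) → type r ns' (pos ∘ ρ) ≡ type r ns ρ
    type-iso zero    ρ = V.tabulate-cong λ x →
      cong₂ _,_ (pos-label (ρ x)) (V.tabulate-cong λ y → pos-cell (ρ x) (ρ y))
    type-iso (suc r) {n} ρ = cong₂ _,_ (type-iso r ρ) (fromPred-cong (Type-finite r (suc n)) λ τ →
      does-⇔ (mk⇔ pull push) (realises? r ns' (pos ∘ ρ) τ) (realises? r ns ρ τ))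
      where
      image : ∀ v → type r ns' (extend (pos v) (pos ∘ ρ)) ≡ type r ns (extend v ρ)
      image v = trans (type-cong r ns' λ { F.zero → refl ; (F.suc x) → refl }) (type-iso r (extend v ρ))
      pull : ∀ {τ} → Realises r ns' (pos ∘ ρ) τ → Realises r ns ρ τ
      pull (v' , e) with pos-onto v'
      ... | v , refl = v , trans (sym (image v)) e
      push : ∀ {τ} → Realises r ns ρ τ → Realises r ns' (pos ∘ ρ) τ
      push (v , e) = pos v , trans (image v) e

  mapValues : (ℕ → ℕ) → Structure → Structure
  mapValues f = L.map (map₂ f)

  lift : ∀ f ns → Fin (length ns) → Fin (length (mapValues f ns))
  lift f (_ ∷ ns) F.zero    = F.zero
  lift f (_ ∷ ns) (F.suc i) = F.suc (lift f ns i)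

  lookup-lift : ∀ f ns i → L.lookup (mapValues f ns) (lift f ns i) ≡ map₂ f (L.lookup ns i)
  lookup-lift f (_ ∷ ns) F.zero    = refl
  lookup-lift f (_ ∷ ns) (F.suc i) = lookup-lift f ns i

  lift-injective : ∀ f ns {i j} → lift f ns i ≡ lift f ns j → i ≡ j
  lift-injective f (_ ∷ ns) {F.zero}  {F.zero}  _ = refl
  lift-injective f (_ ∷ ns) {F.suc i} {F.suc j} e = cong F.suc (lift-injective f ns (F.suc-injective e))

  lift-onto : ∀ f ns v → ∃ λ u → lift f ns u ≡ v
  lift-onto f (_ ∷ ns) F.zero    = F.zero , refl
  lift-onto f (_ ∷ ns) (F.suc v) with lift-onto f ns v
  ... | u , refl = F.suc u , refl

  constant-iso : ∀ {d} d' ns → (∀ i → value ns i ≡ d) → Isomorphism ns (mapValues (const d') ns)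
  constant-iso {d} d' ns const-d = record
    { pos = lift (const d') ns ; pos-injective = lift-injective _ ns ; pos-onto = lift-onto _ ns
    ; pos-label = λ i → cong proj₁ (lookup-lift _ ns i)
    ; pos-∼ = λ i j → mk⇔ (λ _ → trans (const-d i) (sym (const-d j))) (λ _ → trans (value′ i) (sym (value′ j)))
    ; pos-≺ = λ i j → mk⇔ (λ d'<d' → ⊥-elim (N.<-irrefl (trans (value′ i) (sym (value′ j))) d'<d'))
                          (λ d<d → ⊥-elim (N.<-irrefl (trans (const-d i) (sym (const-d j))) d<d)) }
    where
    value′ : ∀ i → value (mapValues (const d') ns) (lift (const d') ns i) ≡ d'
    value′ i = cong proj₂ (lookup-lift _ ns i)

module Composition (ℓ : ℕ) where
  open HintikkaTypes ℓ

  cell-≡ : ∀ ns ns' {i j i' j'} → value ns i ≡ value ns' i' → value ns j ≡ value ns' j' →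
           (i ≡ j ⇔ i' ≡ j') → cell ns i j ≡ cell ns' i' j'
  cell-≡ ns ns' {i} {j} {i'} {j'} ei ej i≡j⇔ = cong₂ _,_ (does-⇔ i≡j⇔ (i F.≟ j) (i' F.≟ j'))
    (cong₂ _,_ (cong₂ (λ u w → does (u N.≟ w)) ei ej) (cong₂ (λ u w → does (u <? w)) ei ej))

  cell-< : ∀ ns {i j} → value ns i < value ns j → cell ns i j ≡ (false , false , true)
  cell-< ns {i} {j} i<j = cong₂ _,_ (dec-false (i F.≟ j) λ { refl → N.<-irrefl refl i<j })
    (cong₂ _,_ (dec-false (value ns i N.≟ value ns j) (N.<⇒≢ i<j)) (dec-true (value ns i <? value ns j) i<j))

  cell-> : ∀ ns {i j} → value ns j < value ns i → cell ns i j ≡ (false , false , false)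
  cell-> ns {i} {j} j<i = cong₂ _,_ (dec-false (i F.≟ j) λ { refl → N.<-irrefl refl j<i })
    (cong₂ _,_ (dec-false (value ns i N.≟ value ns j) (N.>⇒≢ j<i)) (dec-false (value ns i <? value ns j) (N.<⇒≯ j<i)))

  injˡ : ∀ (xs ys : Structure) → Fin (length xs) → Fin (length (xs ++ ys))
  injˡ (x ∷ xs) ys F.zero    = F.zero
  injˡ (x ∷ xs) ys (F.suc i) = F.suc (injˡ xs ys i)

  injʳ : ∀ (xs ys : Structure) → Fin (length ys) → Fin (length (xs ++ ys))
  injʳ []       ys j = j
  injʳ (x ∷ xs) ys j = F.suc (injʳ xs ys j)

  lookup-injˡ : ∀ (xs ys : Structure) i → L.lookup (xs ++ ys) (injˡ xs ys i) ≡ L.lookup xs i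
  lookup-injˡ (x ∷ xs) ys F.zero    = refl
  lookup-injˡ (x ∷ xs) ys (F.suc i) = lookup-injˡ xs ys i

  lookup-injʳ : ∀ (xs ys : Structure) j → L.lookup (xs ++ ys) (injʳ xs ys j) ≡ L.lookup ys j
  lookup-injʳ []       ys j = refl
  lookup-injʳ (x ∷ xs) ys j = lookup-injʳ xs ys j

  injˡ-injective : ∀ (xs ys : Structure) {i j} → injˡ xs ys i ≡ injˡ xs ys j → i ≡ j
  injˡ-injective (x ∷ xs) ys {F.zero}  {F.zero}  e = refl
  injˡ-injective (x ∷ xs) ys {F.suc i} {F.suc j} e = cong F.suc (injˡ-injective xs ys (F.suc-injective e))

  injʳ-injective : ∀ (xs ys : Structure) {i j} → injʳ xs ys i ≡ injʳ xs ys j → i ≡ j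
  injʳ-injective []       ys e = e
  injʳ-injective (x ∷ xs) ys e = injʳ-injective xs ys (F.suc-injective e)

  data Position (xs ys : Structure) : Fin (length (xs ++ ys)) → Set where
    left  : ∀ i → Position xs ys (injˡ xs ys i)
    right : ∀ j → Position xs ys (injʳ xs ys j)

  position : ∀ (xs ys : Structure) v → Position xs ys v
  position []       ys v         = right v
  position (x ∷ xs) ys F.zero    = left F.zero
  position (x ∷ xs) ys (F.suc v) with position xs ys v
  ... | left i  = left (F.suc i)
  ... | right j = right j

  -- where each of the c variables of a tuple over xs ++ ys lives: among the a variables on xs, or the b on ys
  Split : ℕ → ℕ → ℕ → Set
  Split a b c = Fin c → Fin a ⊎ Fin b

  extendˡ : ∀ {a b c} → Split a b c → Split (suc a) b (suc c)
  extendˡ s = extend (inj₁ F.zero) (Sum.map₁ F.suc ∘ s)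

  extendʳ : ∀ {a b c} → Split a b c → Split a (suc b) (suc c)
  extendʳ s = extend (inj₂ F.zero) (Sum.map₂ F.suc ∘ s)

  join : ∀ (xs ys : Structure) {a b c} → Split a b c → (Fin a → Fin (length xs)) → (Fin b → Fin (length ys)) →
         Fin c → Fin (length (xs ++ ys))
  join xs ys s ρ₁ ρ₂ = Sum.[ injˡ xs ys ∘ ρ₁ , injʳ xs ys ∘ ρ₂ ] ∘ s

  join-extendˡ : ∀ (xs ys : Structure) {a b c} (s : Split a b c) ρ₁ ρ₂ i →
                 join xs ys (extendˡ s) (extend i ρ₁) ρ₂ ≗ extend (injˡ xs ys i) (join xs ys s ρ₁ ρ₂)
  join-extendˡ xs ys s ρ₁ ρ₂ i F.zero = refl
  join-extendˡ xs ys s ρ₁ ρ₂ i (F.suc x) with s x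
  ... | inj₁ _ = refl
  ... | inj₂ _ = refl

  join-extendʳ : ∀ (xs ys : Structure) {a b c} (s : Split a b c) ρ₁ ρ₂ j →
                 join xs ys (extendʳ s) ρ₁ (extend j ρ₂) ≗ extend (injʳ xs ys j) (join xs ys s ρ₁ ρ₂)
  join-extendʳ xs ys s ρ₁ ρ₂ j F.zero = refl
  join-extendʳ xs ys s ρ₁ ρ₂ j (F.suc x) with s x
  ... | inj₁ _ = refl
  ... | inj₂ _ = refl

  crossCell : ∀ {a b} → Type zero a → Type zero b → Fin a ⊎ Fin b → Fin a ⊎ Fin b → Cell
  crossCell τ₁ τ₂ (inj₁ x) (inj₁ y) = cellOf τ₁ x y
  crossCell τ₁ τ₂ (inj₂ x) (inj₂ y) = cellOf τ₂ x y
  crossCell τ₁ τ₂ (inj₁ _) (inj₂ _) = false , false , true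
  crossCell τ₁ τ₂ (inj₂ _) (inj₁ _) = false , false , false

  combine : ∀ r {a b c} → Split a b c → Type r a → Type r b → Type r c
  CombinedExtension : ∀ r {a b c} → Split a b c → Type (suc r) a → Type (suc r) b → Type r (suc c) → Set
  combinedExtension? : ∀ r {a b c} s τ₁ τ₂ τ → Dec (CombinedExtension r {a} {b} {c} s τ₁ τ₂ τ)

  combine zero    s τ₁ τ₂ = V.tabulate λ x → Sum.[ labelOf τ₁ , labelOf τ₂ ] (s x) ,
                                          V.tabulate λ y → crossCell τ₁ τ₂ (s x) (s y)
  combine (suc r) {c = c} s τ₁ τ₂ =
    combine r s (proj₁ τ₁) (proj₁ τ₂) , fromPred (Type-finite r (suc c)) (does ∘ combinedExtension? r s τ₁ τ₂)

  -- Each extension of a tuple over xs ++ ys adds a point either to xs or to ys.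
  CombinedExtension r s τ₁ τ₂ τ =
    (∃ λ σ₁ → Extends r τ₁ σ₁ × combine r (extendˡ s) σ₁ (proj₁ τ₂) ≡ τ) ⊎
    (∃ λ σ₂ → Extends r τ₂ σ₂ × combine r (extendʳ s) (proj₁ τ₁) σ₂ ≡ τ)

  combinedExtension? r {a} {b} {c} s τ₁ τ₂ τ =
    ∃? (Type-finite r (suc a)) (λ σ₁ → extends? r τ₁ σ₁ ×-dec
                                        decEq (Type-finite r (suc c)) (combine r (extendˡ s) σ₁ (proj₁ τ₂)) τ)
    ⊎-dec
    ∃? (Type-finite r (suc b)) (λ σ₂ → extends? r τ₂ σ₂ ×-dec
                                        decEq (Type-finite r (suc c)) (combine r (extendʳ s) (proj₁ τ₁) σ₂) τ)

  Below : Structure → Structure → Set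
  Below xs ys = ∀ i j → value xs i < value ys j

  module _ (xs ys : Structure) (xs<ys : Below xs ys) {a b} (ρ₁ : Fin a → Fin (length xs)) (ρ₂ : Fin b → Fin (length ys)) where
    private
      zs : Structure
      zs = xs ++ ys
      place : Fin a ⊎ Fin b → Fin (length zs)
      place = Sum.[ injˡ xs ys ∘ ρ₁ , injʳ xs ys ∘ ρ₂ ]
      valueˡ : ∀ i → value zs (injˡ xs ys i) ≡ value xs i
      valueˡ i = cong proj₂ (lookup-injˡ xs ys i)
      valueʳ : ∀ j → value zs (injʳ xs ys j) ≡ value ys j
      valueʳ j = cong proj₂ (lookup-injʳ xs ys j)

    label-place : ∀ u → label zs (place u) ≡ Sum.[ labelOf (type zero xs ρ₁) , labelOf (type zero ys ρ₂) ] u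
    label-place (inj₁ i) = trans (cong proj₁ (lookup-injˡ xs ys (ρ₁ i))) (sym (labelOf-type zero xs ρ₁ i))
    label-place (inj₂ j) = trans (cong proj₁ (lookup-injʳ xs ys (ρ₂ j))) (sym (labelOf-type zero ys ρ₂ j))

    cell-place : ∀ u u' → cell zs (place u) (place u') ≡ crossCell (type zero xs ρ₁) (type zero ys ρ₂) u u'
    cell-place (inj₁ i) (inj₁ j) = trans (cell-≡ zs xs (valueˡ (ρ₁ i)) (valueˡ (ρ₁ j))
      (mk⇔ (injˡ-injective xs ys) (cong (injˡ xs ys)))) (sym (cellOf-type zero xs ρ₁ i j))
    cell-place (inj₂ i) (inj₂ j) = trans (cell-≡ zs ys (valueʳ (ρ₂ i)) (valueʳ (ρ₂ j))
      (mk⇔ (injʳ-injective xs ys) (cong (injʳ xs ys)))) (sym (cellOf-type zero ys ρ₂ i j))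
    cell-place (inj₁ i) (inj₂ j) = cell-< zs (subst₂ _<_ (sym (valueˡ (ρ₁ i))) (sym (valueʳ (ρ₂ j))) (xs<ys _ _))
    cell-place (inj₂ i) (inj₁ j) = cell-> zs (subst₂ _<_ (sym (valueˡ (ρ₁ j))) (sym (valueʳ (ρ₂ i))) (xs<ys _ _))

  type-++ : ∀ r (xs ys : Structure) → Below xs ys → ∀ {a b c} (s : Split a b c) ρ₁ ρ₂ →
            type r (xs ++ ys) (join xs ys s ρ₁ ρ₂) ≡ combine r s (type r xs ρ₁) (type r ys ρ₂)
  type-++ zero xs ys xs<ys s ρ₁ ρ₂ = V.tabulate-cong λ x →
    cong₂ _,_ (label-place xs ys xs<ys ρ₁ ρ₂ (s x)) (V.tabulate-cong λ y → cell-place xs ys xs<ys ρ₁ ρ₂ (s x) (s y))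
  type-++ (suc r) xs ys xs<ys {c = c} s ρ₁ ρ₂ = cong₂ _,_ (type-++ r xs ys xs<ys s ρ₁ ρ₂)
    (fromPred-cong (Type-finite r (suc c)) λ τ →
      does-⇔ (mk⇔ divide unite) (realises? r (xs ++ ys) ρ τ)
             (combinedExtension? r s (type (suc r) xs ρ₁) (type (suc r) ys ρ₂) τ))
    where
    ρ : Fin c → Fin (length (xs ++ ys))
    ρ = join xs ys s ρ₁ ρ₂
    extendedˡ : ∀ i → type r (xs ++ ys) (extend (injˡ xs ys i) ρ) ≡
                      combine r (extendˡ s) (type r xs (extend i ρ₁)) (type r ys ρ₂)
    extendedˡ i = trans (sym (type-cong r (xs ++ ys) (join-extendˡ xs ys s ρ₁ ρ₂ i)))
                        (type-++ r xs ys xs<ys (extendˡ s) (extend i ρ₁) ρ₂)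
    extendedʳ : ∀ j → type r (xs ++ ys) (extend (injʳ xs ys j) ρ) ≡
                      combine r (extendʳ s) (type r xs ρ₁) (type r ys (extend j ρ₂))
    extendedʳ j = trans (sym (type-cong r (xs ++ ys) (join-extendʳ xs ys s ρ₁ ρ₂ j)))
                        (type-++ r xs ys xs<ys (extendʳ s) ρ₁ (extend j ρ₂))
    divide : ∀ {τ} → Realises r (xs ++ ys) ρ τ → CombinedExtension r s (type (suc r) xs ρ₁) (type (suc r) ys ρ₂) τ
    divide (v , e) with position xs ys v
    ... | left i  = inj₁ (_ , from (Extends-type r xs ρ₁ _) (i , refl) , trans (sym (extendedˡ i)) e)
    ... | right j = inj₂ (_ , from (Extends-type r ys ρ₂ _) (j , refl) , trans (sym (extendedʳ j)) e)
    unite : ∀ {τ} → CombinedExtension r s (type (suc r) xs ρ₁) (type (suc r) ys ρ₂) τ → Realises r (xs ++ ys) ρ τ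
    unite (inj₁ (σ , m , e)) with to (Extends-type r xs ρ₁ σ) m
    ... | i , refl = injˡ xs ys i , trans (extendedˡ i) e
    unite (inj₂ (σ , m , e)) with to (Extends-type r ys ρ₂ σ) m
    ... | j , refl = injʳ xs ys j , trans (extendedʳ j) e

module Counting (ℓ : ℕ) where
  open HintikkaTypes ℓ using (Structure)

  Matches : Fin ℓ → ℕ → Node ℓ → Bool
  Matches a d (b , e) = does (a F.≟ b) ∧ does (d N.≟ e)

  Matches⇒≡ : ∀ a d x → Matches a d x ≡ true → x ≡ (a , d)
  Matches⇒≡ a d (b , e) m with to T-∧ (subst T (sym m) _)
  ... | a≡b , d≡e with to (T-does (a F.≟ b)) a≡b | to (T-does (d N.≟ e)) d≡e
  ... | refl | refl = refl

  ≡⇒Matches : ∀ a d x → x ≡ (a , d) → Matches a d x ≡ true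
  ≡⇒Matches a d _ refl = cong₂ _∧_ (dec-true (a F.≟ a) refl) (dec-true (d N.≟ d) refl)

  occurrence : ∀ ns a d → Fin (count a d ns) → Fin (length ns)
  occurrence (x ∷ ns) a d t with Matches a d x
  occurrence (x ∷ ns) a d F.zero    | true  = F.zero
  occurrence (x ∷ ns) a d (F.suc t) | true  = F.suc (occurrence ns a d t)
  occurrence (x ∷ ns) a d t         | false = F.suc (occurrence ns a d t)

  lookup-occurrence : ∀ ns a d t → L.lookup ns (occurrence ns a d t) ≡ (a , d)
  lookup-occurrence (x ∷ ns) a d t with Matches a d x in m
  lookup-occurrence (x ∷ ns) a d F.zero    | true  = Matches⇒≡ a d x m
  lookup-occurrence (x ∷ ns) a d (F.suc t) | true  = lookup-occurrence ns a d t
  lookup-occurrence (x ∷ ns) a d t         | false = lookup-occurrence ns a d t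

  occurrence-injective : ∀ ns a d {t t'} → occurrence ns a d t ≡ occurrence ns a d t' → t ≡ t'
  occurrence-injective (x ∷ ns) a d {t} {t'} same with Matches a d x
  occurrence-injective (x ∷ ns) a d {F.zero}  {F.zero}   same | true = refl
  occurrence-injective (x ∷ ns) a d {F.suc t} {F.suc t'} same | true =
    cong F.suc (occurrence-injective ns a d (F.suc-injective same))
  occurrence-injective (x ∷ ns) a d same | false = occurrence-injective ns a d (F.suc-injective same)

  occurrence-onto : ∀ ns a d u → L.lookup ns u ≡ (a , d) → ∃ λ t → occurrence ns a d t ≡ u
  occurrence-onto (x ∷ ns) a d u at with Matches a d x in m
  occurrence-onto (x ∷ ns) a d F.zero    at | true = F.zero , refl
  occurrence-onto (x ∷ ns) a d (F.suc u) at | true with occurrence-onto ns a d u at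
  ... | t , refl = F.suc t , refl
  occurrence-onto (x ∷ ns) a d F.zero    at | false with trans (sym m) (≡⇒Matches a d x at)
  ... | ()
  occurrence-onto (x ∷ ns) a d (F.suc u) at | false with occurrence-onto ns a d u at
  ... | t , refl = t , refl

  ≤-count : ∀ ns a d {m} (f : Fin m → Fin (length ns)) → (∀ {i j} → f i ≡ f j → i ≡ j) →
            (∀ i → L.lookup ns (f i) ≡ (a , d)) → m ≤ count a d ns
  ≤-count ns a d f f-injective f-occurs = F.injective⇒≤ {f = index} λ {i} {j} e →
    f-injective (trans (sym (proj₂ (onto i))) (trans (cong (occurrence ns a d) e) (proj₂ (onto j))))
    where
    onto : ∀ i → ∃ λ t → occurrence ns a d t ≡ f i
    onto i = occurrence-onto ns a d (f i) (f-occurs i)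
    index : Fin _ → Fin (count a d ns)
    index = proj₁ ∘ onto

  ∈⇒count : ∀ ns a d → (a , d) ∈ᴸ ns → 1 ≤ count a d ns
  ∈⇒count ns a d p = ≤-count ns a d {1} (const (Any.index p)) (λ { {F.zero} {F.zero} _ → refl })
                                        (λ _ → sym (lookup-index p))

  count⇒∈ : ∀ ns a d → 1 ≤ count a d ns → (a , d) ∈ᴸ ns
  count⇒∈ ns a d 0<count = subst (_∈ᴸ ns) (lookup-occurrence ns a d t) (∈-lookup (occurrence ns a d t))
    where
    t : Fin (count a d ns)
    t = F.fromℕ< 0<count

  count-++ : ∀ a d xs ys → count a d (xs ++ ys) ≡ count a d xs + count a d ys
  count-++ a d []       ys = refl
  count-++ a d (x ∷ xs) ys with Matches a d x
  ... | true  = cong suc (count-++ a d xs ys)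
  ... | false = count-++ a d xs ys

  count≡0 : ∀ ns a d → (a , d) ∉ᴸ ns → count a d ns ≡ 0
  count≡0 ns a d ∉ns with count a d ns in c
  ... | zero  = refl
  ... | suc _ = ⊥-elim (∉ns (count⇒∈ ns a d (subst (1 ≤_) (sym c) (s≤s z≤n))))

  count-absent : ∀ {P : ℕ → Set} ns {a d} → All (P ∘ proj₂) ns → ¬ P d → count a d ns ≡ 0
  count-absent ns {a} {d} values ¬Pd = count≡0 ns a d (¬Pd ∘ All.lookup values)

  count-replicate : ∀ a d n → count a d (replicate n (a , d)) ≡ n
  count-replicate a d zero    = refl
  count-replicate a d (suc n) rewrite ≡⇒Matches a d (a , d) refl = cong suc (count-replicate a d n)

  column : (Fin ℓ → ℕ) → ℕ → List (Fin ℓ) → Structure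
  column m d = concatMap (λ b → replicate (m b) (b , d))

  column-labels : ∀ m d bs → All (λ x → proj₁ x ∈ᴸ bs) (column m d bs)
  column-labels m d bs = All.concat⁺ (All.map⁺ (All.tabulate λ {b} b∈bs → All.replicate⁺ (m b) b∈bs))

  count-column : ∀ m a d {bs} → Unique bs → a ∈ᴸ bs → count a d (column m d bs) ≡ m a
  count-column m a d {b ∷ bs} (b∉bs ∷ _) (here refl) = begin
    count a d (replicate (m a) (a , d) ++ column m d bs)             ≡⟨ count-++ a d (replicate (m a) (a , d)) _ ⟩
    count a d (replicate (m a) (a , d)) + count a d (column m d bs) ≡⟨ cong₂ _+_ (count-replicate a d (m a)) (count≡0 _ a d a∉) ⟩
    m a + 0                                                          ≡⟨ N.+-identityʳ (m a) ⟩
    m a                                                              ∎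
    where
    open ≡-Reasoning
    a∉ : (a , d) ∉ᴸ column m d bs
    a∉ a∈ = All.lookup b∉bs (All.lookup (column-labels m d bs) a∈) refl
  count-column m a d {b ∷ bs} (b∉bs ∷ unique) (there a∈bs) = trans (count-++ a d (replicate (m b) (b , d)) _)
    (cong₂ _+_ (count≡0 _ a d a∉) (count-column m a d unique a∈bs))
    where
    a∉ : (a , d) ∉ᴸ replicate (m b) (b , d)
    a∉ a∈ = All.lookup b∉bs a∈bs (sym (All.lookup (All.replicate⁺ {P = λ n → proj₁ n ≡ b} (m b) refl) a∈))

module ThresholdInvariance (ℓ : ℕ) where
  open HintikkaTypes ℓ using (Structure; label; value)
  open Counting ℓ

  _≈[_]_ : Structure → ℕ → Structure → Set
  ns ≈[ K ] ns' = ∀ a d → count a d ns ≡ count a d ns' ⊎ (K ≤ count a d ns × K ≤ count a d ns')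

  ≈-sym : ∀ {ns K ns'} → ns ≈[ K ] ns' → ns' ≈[ K ] ns
  ≈-sym ns≈ns' a d with ns≈ns' a d
  ... | inj₁ c≡c'       = inj₁ (sym c≡c')
  ... | inj₂ (K≤c , K≤c') = inj₂ (K≤c' , K≤c)

  record PartialIso (ns ns' : Structure) {n} (ρ : Fin n → Fin (length ns)) (ρ' : Fin n → Fin (length ns')) : Set where
    field
      same-node     : ∀ x → L.lookup ns (ρ x) ≡ L.lookup ns' (ρ' x)
      same-position : ∀ x y → ρ x ≡ ρ y ⇔ ρ' x ≡ ρ' y
  open PartialIso

  module _ {ns ns' n} {ρ : Fin n → Fin (length ns)} {ρ'} (π : PartialIso ns ns' ρ ρ') where
    same-label : ∀ x → label ns (ρ x) ≡ label ns' (ρ' x)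
    same-label x = cong proj₁ (same-node π x)

    same-value : ∀ x → value ns (ρ x) ≡ value ns' (ρ' x)
    same-value x = cong proj₂ (same-node π x)

  PartialIso-sym : ∀ {ns ns' n} {ρ : Fin n → Fin (length ns)} {ρ'} → PartialIso ns ns' ρ ρ' → PartialIso ns' ns ρ' ρ
  PartialIso-sym π = record
    { same-node = sym ∘ same-node π
    ; same-position = λ x y → let e = same-position π x y in mk⇔ (from e) (to e) }

  PartialIso-extend : ∀ {ns ns' n} {ρ : Fin n → Fin (length ns)} {ρ'} → PartialIso ns ns' ρ ρ' →
    ∀ {v v'} → L.lookup ns v ≡ L.lookup ns' v' → (∀ x → ρ x ≡ v ⇔ ρ' x ≡ v') →
    PartialIso ns ns' (extend v ρ) (extend v' ρ')
  PartialIso-extend {ns} {ns'} {ρ = ρ} {ρ'} π {v} {v'} same-v old≡new =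
    record { same-node = same-node′ ; same-position = same-position′ }
    where
    same-node′ : ∀ x → L.lookup ns (extend v ρ x) ≡ L.lookup ns' (extend v' ρ' x)
    same-node′ F.zero    = same-v
    same-node′ (F.suc x) = same-node π x
    same-position′ : ∀ x y → extend v ρ x ≡ extend v ρ y ⇔ extend v' ρ' x ≡ extend v' ρ' y
    same-position′ F.zero    F.zero    = mk⇔ (const refl) (const refl)
    same-position′ F.zero    (F.suc y) = mk⇔ (sym ∘ to (old≡new y) ∘ sym) (sym ∘ from (old≡new y) ∘ sym)
    same-position′ (F.suc x) F.zero    = old≡new x
    same-position′ (F.suc x) (F.suc y) = same-position π x y

  module _ {ns ns' K} (ns≈ns' : ns ≈[ K ] ns') {n} (n<K : n < K)
           {ρ : Fin n → Fin (length ns)} {ρ'} (π : PartialIso ns ns' ρ ρ') where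

    fresh-copy : ∀ v → (∀ x → ρ x ≢ v) → ∃ λ v' → L.lookup ns' v' ≡ L.lookup ns v × (∀ x → ρ' x ≢ v')
    fresh-copy v v-new with L.lookup ns v in at-v
    ... | (a , d) with F.all? (λ t → F.any? (λ x → ρ' x F.≟ occurrence ns' a d t))
    ...   | no some-free = let t , t-free = F.¬∀⟶∃¬ _ _ (λ t → F.any? (λ x → ρ' x F.≟ occurrence ns' a d t)) some-free
                           in occurrence ns' a d t , lookup-occurrence ns' a d t , λ x e → t-free (x , e)
    ...   | yes covered = ⊥-elim (too-many-copies (ns≈ns' a d))
      -- Every copy in ns' carries a pebble: their partners under ρ, together with v, are
      -- more copies than ns' has, while the pebbles are fewer than K.
      where
      preimage : Fin (count a d ns') → Fin n
      preimage t = proj₁ (covered t)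
      hits : ∀ t → ρ' (preimage t) ≡ occurrence ns' a d t
      hits t = proj₂ (covered t)
      preimage-injective : ∀ {t t'} → preimage t ≡ preimage t' → t ≡ t'
      preimage-injective {t} {t'} e = occurrence-injective ns' a d (trans (sym (hits t)) (trans (cong ρ' e) (hits t')))
      copies : Fin (suc (count a d ns')) → Fin (length ns)
      copies = extend v (ρ ∘ preimage)
      copies-injective : ∀ {i j} → copies i ≡ copies j → i ≡ j
      copies-injective {F.zero}  {F.zero}  _ = refl
      copies-injective {F.zero}  {F.suc j} e = ⊥-elim (v-new _ (sym e))
      copies-injective {F.suc i} {F.zero}  e = ⊥-elim (v-new _ e)
      copies-injective {F.suc i} {F.suc j} e = cong F.suc (occurrence-injective ns' a d
        (trans (sym (hits i)) (trans (to (same-position π _ _) e) (hits j))))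
      copies-occur : ∀ i → L.lookup ns (copies i) ≡ (a , d)
      copies-occur F.zero    = at-v
      copies-occur (F.suc t) = trans (same-node π (preimage t))
        (trans (cong (L.lookup ns') (hits t)) (lookup-occurrence ns' a d t))
      too-many-copies : count a d ns ≡ count a d ns' ⊎ (K ≤ count a d ns × K ≤ count a d ns') → ⊥
      too-many-copies (inj₁ c≡c') = N.<-irrefl (sym c≡c') (≤-count ns a d copies copies-injective copies-occur)
      too-many-copies (inj₂ (_ , K≤c')) =
        N.<-irrefl refl (N.<-≤-trans n<K (N.≤-trans K≤c' (F.injective⇒≤ preimage-injective)))

    back-and-forth : ∀ v → ∃ λ v' → PartialIso ns ns' (extend v ρ) (extend v' ρ')
    back-and-forth v with F.any? (λ x → ρ x F.≟ v)
    ... | yes (x₀ , ρx₀≡v) = ρ' x₀ , PartialIso-extend π (trans (cong (L.lookup ns) (sym ρx₀≡v)) (same-node π x₀))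
      λ x → mk⇔ (λ ρx≡v → to (same-position π x x₀) (trans ρx≡v (sym ρx₀≡v)))
                (λ ρ'x≡ρ'x₀ → trans (from (same-position π x x₀) ρ'x≡ρ'x₀) ρx₀≡v)
    ... | no v-new with fresh-copy v (λ x e → v-new (x , e))
    ...   | v' , same-v , v'-new = v' , PartialIso-extend π (sym same-v)
      λ x → mk⇔ (λ e → ⊥-elim (v-new (x , e))) (λ e → ⊥-elim (v'-new x e))

  ⊔-boundˡ : ∀ n {p q K} → n + (p N.⊔ q) ≤ K → n + p ≤ K
  ⊔-boundˡ n {p} {q} = N.≤-trans (N.+-monoʳ-≤ n (N.m≤m⊔n p q))

  ⊔-boundʳ : ∀ n {p q K} → n + (p N.⊔ q) ≤ K → n + q ≤ K
  ⊔-boundʳ n {p} {q} = N.≤-trans (N.+-monoʳ-≤ n (N.m≤n⊔m p q))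

  suc-bound : ∀ n {q K} → n + suc q ≤ K → suc n + q ≤ K
  suc-bound n {q} {K} = subst (_≤ K) (N.+-suc n q)

  -- Ehrenfeucht–Fraïssé: with n pebbles placed and qr φ rounds to go, K copies of each node suffice.
  Sat-invariant : ∀ {ns ns' K} → ns ≈[ K ] ns' → ∀ {n} (φ : Formula ℓ n) → n + qr φ ≤ K →
    ∀ {ρ : Fin n → Fin (length ns)} {ρ'} → PartialIso ns ns' ρ ρ' → Sat ns φ ρ ⇔ Sat ns' φ ρ'
  Sat-invariant ns≈ns' (lab a x)  _ π = mk⇔ (trans (sym (same-label π x))) (trans (same-label π x))
  Sat-invariant ns≈ns' (eq x y)   _ π = same-position π x y
  Sat-invariant ns≈ns' (sim x y)  _ π = mk⇔ (λ e → trans (sym (same-value π x)) (trans e (same-value π y)))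
                                            (λ e → trans (same-value π x) (trans e (sym (same-value π y))))
  Sat-invariant ns≈ns' (prec x y) _ π = mk⇔ (subst₂ _<_ (same-value π x) (same-value π y))
                                            (subst₂ _<_ (sym (same-value π x)) (sym (same-value π y)))
  Sat-invariant ns≈ns' (neg φ) b π = ¬-⇔ (Sat-invariant ns≈ns' φ b π)
  Sat-invariant ns≈ns' {n} (and φ ψ) b π =
    Sat-invariant ns≈ns' φ (⊔-boundˡ n b) π ×-⇔ Sat-invariant ns≈ns' ψ (⊔-boundʳ n b) π
  Sat-invariant ns≈ns' {n} (or φ ψ) b π =
    Sat-invariant ns≈ns' φ (⊔-boundˡ n b) π ⊎-⇔ Sat-invariant ns≈ns' ψ (⊔-boundʳ n b) π
  Sat-invariant {ns} {ns'} {K} ns≈ns' {n} (ex φ) b {ρ} {ρ'} π = mk⇔ forth back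
    where
    n<K : n < K
    n<K = N.≤-trans (N.m≤m+n (suc n) (qr φ)) (suc-bound n b)
    forth : Sat ns (ex φ) ρ → Sat ns' (ex φ) ρ'
    forth (v , s) with back-and-forth ns≈ns' n<K π v
    ... | v' , π' = v' , to (Sat-invariant ns≈ns' φ (suc-bound n b) π') s
    back : Sat ns' (ex φ) ρ' → Sat ns (ex φ) ρ
    back (v' , s) with back-and-forth (≈-sym {ns} {K} {ns'} ns≈ns') n<K (PartialIso-sym π) v'
    ... | v , π' = v , from (Sat-invariant ns≈ns' φ (suc-bound n b) (PartialIso-sym π')) s
  Sat-invariant {ns} {ns'} {K} ns≈ns' {n} (all φ) b {ρ} {ρ'} π = mk⇔ forth back
    where
    n<K : n < K
    n<K = N.≤-trans (N.m≤m+n (suc n) (qr φ)) (suc-bound n b)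
    forth : Sat ns (all φ) ρ → Sat ns' (all φ) ρ'
    forth s v' with back-and-forth (≈-sym {ns} {K} {ns'} ns≈ns') n<K (PartialIso-sym π) v'
    ... | v , π' = to (Sat-invariant ns≈ns' φ (suc-bound n b) (PartialIso-sym π')) (s v)
    back : Sat ns' (all φ) ρ' → Sat ns (all φ) ρ
    back s v with back-and-forth ns≈ns' n<K π v
    ... | v' , π' = from (Sat-invariant ns≈ns' φ (suc-bound n b) π') (s v')

module CanonicalModel (ℓ k : ℕ) where
  open HintikkaTypes ℓ
  open IsomorphismInvariance ℓ
  open Composition ℓ
  open Counting ℓ

  Profile : Set
  Profile = Subset ℓ × FunGK ℓ k

  multiplicity : Profile → Fin ℓ → ℕ
  multiplicity (_ , f) a = toℕ (f a)

  labels : Profile → List (Fin ℓ)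
  labels x = concatMap (λ a → replicate (multiplicity x a) a) (allFin ℓ)

  blockAt : Profile → ℕ → Structure
  blockAt x d = L.map (_, d) (labels x)

  model : ℕ → List Profile → Structure
  model d₀ []      = []
  model d₀ (x ∷ w) = blockAt x d₀ ++ model (suc d₀) w

  Good : Profile → Set
  Good x = WellFormedLetter x × ∃ λ a → 1 ≤ multiplicity x a

  good? : ∀ x → Dec (Good x)
  good? x = F.all? (λ a → ((a Subset.∈? proj₁ x) →-dec (1 ≤? multiplicity x a))
                    ×-dec ((1 ≤? multiplicity x a) →-dec (a Subset.∈? proj₁ x)))
            ×-dec F.any? (λ a → 1 ≤? multiplicity x a)

  blockAt-column : ∀ x d → blockAt x d ≡ column (multiplicity x) d (allFin ℓ)
  blockAt-column x d = trans (L.map-concatMap (_, d) _ (allFin ℓ))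
    (L.concatMap-cong (λ a → L.map-replicate (_, d) (multiplicity x a) a) (allFin ℓ))

  count-blockAt : ∀ x a d → count a d (blockAt x d) ≡ multiplicity x a
  count-blockAt x a d rewrite blockAt-column x d = count-column (multiplicity x) a d (allFin⁺ ℓ) (∈-allFin a)

  values-blockAt : ∀ x d → All (λ n → proj₂ n ≡ d) (blockAt x d)
  values-blockAt x d = All.map⁺ (All.tabulate λ _ → refl)

  values-model : ∀ d₀ w → All (λ n → d₀ ≤ proj₂ n × proj₂ n < d₀ + length w) (model d₀ w)
  values-model d₀ []      = []
  values-model d₀ (x ∷ w) = All.++⁺ (All.map (λ { refl → N.≤-refl , N.m<m+n d₀ (s≤s z≤n) }) (values-blockAt x d₀))
    (All.map (λ {n} (lo , hi) → N.<⇒≤ lo , subst (proj₂ n <_) (sym (N.+-suc d₀ (length w))) hi) (values-model (suc d₀) w))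

  count-model : ∀ d₀ w a (i : Fin (length w)) → count a (d₀ + toℕ i) (model d₀ w) ≡ multiplicity (L.lookup w i) a
  count-model d₀ (x ∷ w) a F.zero rewrite N.+-identityʳ d₀ =
    trans (count-++ a d₀ (blockAt x d₀) _) (trans (cong₂ _+_ (count-blockAt x a d₀)
      (count-absent (model (suc d₀) w) (values-model (suc d₀) w) (λ (lo , _) → N.<-irrefl refl lo)))
      (N.+-identityʳ _))
  count-model d₀ (x ∷ w) a (F.suc i) rewrite N.+-suc d₀ (toℕ i) =
    trans (count-++ a _ (blockAt x d₀) _) (cong₂ _+_
      (count-absent (blockAt x d₀) (values-blockAt x d₀) (λ e → N.<-irrefl (sym e) (s≤s (N.m≤m+n d₀ (toℕ i)))))
      (count-model (suc d₀) w a i))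

  count-model-outside : ∀ d₀ w a d → ¬ (d₀ ≤ d × d < d₀ + length w) → count a d (model d₀ w) ≡ 0
  count-model-outside d₀ w a d = count-absent (model d₀ w) (values-model d₀ w)

  type-blockAt : ∀ r x d d' → type r {0} (blockAt x d') (λ ()) ≡ type r {0} (blockAt x d) (λ ())
  type-blockAt r x d d' = subst (λ ns → type r {0} ns (λ ()) ≡ type r {0} (blockAt x d) (λ ())) shifted
    (trans (type-cong r (mapValues (const d') (blockAt x d)) λ ())
           (type-iso (constant-iso d' (blockAt x d) (All.lookup (values-blockAt x d) ∘ ∈-lookup)) r λ ()))
    where
    shifted : mapValues (const d') (blockAt x d) ≡ blockAt x d'
    shifted = sym (L.map-∘ (labels x))

  model-snoc : ∀ d₀ w x → model d₀ (w ++ [ x ]) ≡ model d₀ w ++ blockAt x (d₀ + length w)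
  model-snoc d₀ []      x = trans (L.++-identityʳ _) (cong (blockAt x) (sym (N.+-identityʳ d₀)))
  model-snoc d₀ (y ∷ w) x = begin
    blockAt y d₀ ++ model (suc d₀) (w ++ [ x ])
      ≡⟨ cong (blockAt y d₀ ++_) (model-snoc (suc d₀) w x) ⟩
    blockAt y d₀ ++ (model (suc d₀) w ++ blockAt x (suc d₀ + length w))
      ≡⟨ L.++-assoc (blockAt y d₀) _ _ ⟨
    model d₀ (y ∷ w) ++ blockAt x (suc d₀ + length w)
      ≡⟨ cong (λ d → model d₀ (y ∷ w) ++ blockAt x d) (N.+-suc d₀ (length w)) ⟨
    model d₀ (y ∷ w) ++ blockAt x (d₀ + length (y ∷ w))
      ∎
    where open ≡-Reasoning

  noVariables : Split 0 0 0
  noVariables ()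

  wordType : List Profile → Type k 0
  wordType w = type k {0} (model 1 w) λ ()

  step : Type k 0 → Profile → Type k 0
  step τ x = combine k noVariables τ (type k {0} (blockAt x 1) λ ())

  wordType-snoc : ∀ w x → wordType (w ++ [ x ]) ≡ step (wordType w) x
  wordType-snoc w x = begin
    type k {0} (model 1 (w ++ [ x ])) (λ ())
      ≡⟨ cong (λ ns → type k ns λ ()) (model-snoc 1 w x) ⟩
    type k {0} (model 1 w ++ last) (λ ())
      ≡⟨ type-cong k (model 1 w ++ last) (λ ()) ⟩
    type k (model 1 w ++ last) (join (model 1 w) last noVariables (λ ()) (λ ()))
      ≡⟨ type-++ k (model 1 w) last below noVariables (λ ()) (λ ()) ⟩
    combine k noVariables (wordType w) (type k last λ ())
      ≡⟨ cong (combine k noVariables (wordType w)) (type-blockAt k x 1 _) ⟩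
    step (wordType w) x
      ∎
    where
    open ≡-Reasoning
    last : Structure
    last = blockAt x (1 + length w)
    below : Below (model 1 w) last
    below i j = subst (_ <_) (sym (All.lookup (values-blockAt x _) (∈-lookup j)))
                      (proj₂ (All.lookup (values-model 1 w) (∈-lookup i)))

  foldl-step : ∀ w₀ w → foldl step (wordType w₀) w ≡ wordType (w₀ ++ w)
  foldl-step w₀ []      = cong wordType (sym (L.++-identityʳ w₀))
  foldl-step w₀ (x ∷ w) = begin
    foldl step (step (wordType w₀) x) w  ≡⟨ cong (λ τ → foldl step τ w) (wordType-snoc w₀ x) ⟨
    foldl step (wordType (w₀ ++ [ x ])) w ≡⟨ foldl-step (w₀ ++ [ x ]) w ⟩
    wordType ((w₀ ++ [ x ]) ++ w)         ≡⟨ cong wordType (L.++-assoc w₀ [ x ] w) ⟩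
    wordType (w₀ ++ x ∷ w)                ∎
    where open ≡-Reasoning

module FiniteMachine {A Q : Set} (_≟_ : DecidableEquality Q) (δ : Q → A → Q) (q₀ : Q) (accepting : Q → Bool)
  (Inv : Q → Set) (inv₀ : Inv q₀) (inv-δ : ∀ q a → Inv q → Inv (δ q a))
  (states : List Q) (states-complete : ∀ q → Inv q → q ∈ᴸ states) where

  -- states missing from the list never occur on a run; they are sent to the position of q₀
  index : Q → Fin (length states)
  index q with Any.any? (q ≟_) states
  ... | yes q∈ = Any.index q∈
  ... | no _   = Any.index (states-complete q₀ inv₀)

  lookup-index′ : ∀ q → q ∈ᴸ states → L.lookup states (index q) ≡ q
  lookup-index′ q q∈ with Any.any? (q ≟_) states
  ... | yes q∈′ = sym (lookup-index q∈′)
  ... | no q∉   = ⊥-elim (q∉ q∈)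

  dfa : DFA A
  dfa = record
    { nStates = length states ; init = index q₀
    ; δ = λ i a → index (δ (L.lookup states i) a) ; final = accepting ∘ L.lookup states }

  lookup-run : ∀ u {i q} → L.lookup states i ≡ q → Inv q → L.lookup states (foldl (DFA.δ dfa) i u) ≡ foldl δ q u
  lookup-run []      at-q _     = at-q
  lookup-run (a ∷ u) {i} refl inv-q = lookup-run u (lookup-index′ _ (states-complete _ inv)) inv
    where
    inv : Inv (δ (L.lookup states i) a)
    inv = inv-δ _ a inv-q

  final-run : ∀ u → DFA.final dfa (foldl (DFA.δ dfa) (DFA.init dfa) u) ≡ accepting (foldl δ q₀ u)
  final-run u = cong accepting (lookup-run u (lookup-index′ q₀ (states-complete q₀ inv₀)) inv₀)

module WordAutomaton (ℓ k : ℕ) (ψ : Sentence ℓ) (qrψ≤k : qr ψ ≤ k) where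
  open HintikkaTypes ℓ
  open CanonicalModel ℓ k

  -- the label letters read since the last profile letter, the type of the model of the profiles read,
  -- and whether at least one profile has been read; nothing is the rejecting sink
  State : Set
  State = Maybe (List (Fin ℓ) × Type k 0 × Bool)

  δ : State → Letter ℓ k → State
  δ nothing _ = nothing
  δ (just (p , τ , b)) (inj₁ a) with suc (length p) ≤? ℓ * k
  ... | yes _ = just (p ++ [ a ] , τ , b)
  ... | no _  = nothing
  δ (just (p , τ , b)) (inj₂ x) with good? x | L.≡-dec F._≟_ p (labels x)
  ... | yes _ | yes _ = just ([] , step τ x , true)
  ... | yes _ | no _  = nothing
  ... | no _  | _     = nothing

  accepting : State → Bool
  accepting (just ([] , τ , true)) = eval ψ k qrψ≤k τ
  accepting _                      = false

  Bounded : State → Set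
  Bounded nothing            = ⊤
  Bounded (just (p , _ , _)) = length p ≤ ℓ * k

  Bounded-δ : ∀ q a → Bounded q → Bounded (δ q a)
  Bounded-δ nothing            _        _ = tt
  Bounded-δ (just (p , τ , b)) (inj₁ a) _ with suc (length p) ≤? ℓ * k
  ... | yes room = subst (_≤ ℓ * k) (trans (N.+-comm 1 (length p)) (sym (L.length-++ p))) room
  ... | no _     = tt
  Bounded-δ (just (p , τ , b)) (inj₂ x) _ with good? x | L.≡-dec F._≟_ p (labels x)
  ... | yes _ | yes _ = z≤n
  ... | yes _ | no _  = tt
  ... | no _  | _     = tt

  states : List State
  states = nothing ∷ L.map just (cartesianProduct (boundedLists (Fin-finite ℓ) (ℓ * k))
                                                  (elements (×-finite (Type-finite k 0) Bool-finite)))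

  states-complete : ∀ q → Bounded q → q ∈ᴸ states
  states-complete nothing            _     = here refl
  states-complete (just (p , τ , b)) bound = there (∈-map⁺ just (∈-cartesianProduct⁺
    (∈-boundedLists (Fin-finite ℓ) p bound) (complete (×-finite (Type-finite k 0) Bool-finite) (τ , b))))

  q₀ : State
  q₀ = just ([] , wordType [] , false)

  open FiniteMachine (Maybe.≡-dec (×.≡-dec (L.≡-dec F._≟_) (×.≡-dec (decEq (Type-finite k 0)) B._≟_)))
                     δ q₀ accepting Bounded z≤n Bounded-δ states states-complete
    public using (dfa; final-run)

  Accepting : State → List (Letter ℓ k) → Set
  Accepting q u = accepting (foldl δ q u) ≡ true

  dead : ∀ u → foldl δ nothing u ≡ nothing
  dead []      = refl
  dead (_ ∷ u) = dead u

  dead-rejects : ∀ u → ¬ Accepting nothing u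
  dead-rejects u accepted with () ← trans (sym (cong accepting (dead u))) accepted

  read-labels : ∀ ps p τ b → length (p ++ ps) ≤ ℓ * k →
                foldl δ (just (p , τ , b)) (L.map inj₁ ps) ≡ just (p ++ ps , τ , b)
  read-labels []       p τ b _     = cong (λ p′ → just (p′ , τ , b)) (sym (L.++-identityʳ p))
  read-labels (a ∷ ps) p τ b bound with suc (length p) ≤? ℓ * k
  ... | yes _ = trans (read-labels ps (p ++ [ a ]) τ b (subst (_≤ ℓ * k) (cong length (sym assoc)) bound))
                      (cong (λ p′ → just (p′ , τ , b)) assoc)
    where
    assoc : (p ++ [ a ]) ++ ps ≡ p ++ a ∷ ps
    assoc = L.++-assoc p [ a ] ps
  ... | no full = ⊥-elim (full (N.≤-trans (subst (suc (length p) ≤_) (sym (L.length-++-sucʳ p a ps))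
                                                  (s≤s (L.length-++-≤ˡ p))) bound))

  length-replicates : ∀ (m : Fin ℓ → ℕ) → (∀ a → m a ≤ k) → ∀ as →
                      length (concatMap (λ a → replicate (m a) a) as) ≤ length as * k
  length-replicates m m≤k []       = z≤n
  length-replicates m m≤k (a ∷ as) = subst (_≤ k + length as * k)
    (sym (trans (L.length-++ (replicate (m a) a)) (cong (_+ _) (L.length-replicate (m a)))))
    (N.+-mono-≤ (m≤k a) (length-replicates m m≤k as))

  length-labels : ∀ x → length (labels x) ≤ ℓ * k
  length-labels x = subst (λ n → length (labels x) ≤ n * k) (L.length-tabulate {n = ℓ} (λ a → a))
    (length-replicates (multiplicity x) (F.toℕ≤pred[n] ∘ proj₂ x) (allFin ℓ))

  block-labels : ∀ x → block x ≡ L.map inj₁ (labels x) ++ [ inj₂ x ]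
  block-labels x = cong (_++ [ inj₂ x ]) (sym (trans (L.map-concatMap inj₁ _ (allFin ℓ))
    (L.concatMap-cong (λ a → L.map-replicate inj₁ (multiplicity x a) a) (allFin ℓ))))

  read-block : ∀ x τ b → foldl δ (just ([] , τ , b)) (block x) ≡ δ (just (labels x , τ , b)) (inj₂ x)
  read-block x τ b = begin
    foldl δ (just ([] , τ , b)) (block x)                                  ≡⟨ cong (foldl δ _) (block-labels x) ⟩
    foldl δ (just ([] , τ , b)) (L.map inj₁ (labels x) ++ [ inj₂ x ])      ≡⟨ L.foldl-++ δ _ (L.map inj₁ (labels x)) _ ⟩
    δ (foldl δ (just ([] , τ , b)) (L.map inj₁ (labels x))) (inj₂ x)       ≡⟨ cong (λ q → δ q (inj₂ x)) (read-labels (labels x) [] τ b (length-labels x)) ⟩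
    δ (just (labels x , τ , b)) (inj₂ x)                                   ∎
    where open ≡-Reasoning

  δ-good : ∀ x τ b → Good x → δ (just (labels x , τ , b)) (inj₂ x) ≡ just ([] , step τ x , true)
  δ-good x τ b good with good? x | L.≡-dec F._≟_ (labels x) (labels x)
  ... | yes _ | yes _ = refl
  ... | yes _ | no p≢p = ⊥-elim (p≢p refl)
  ... | no bad | _     = ⊥-elim (bad good)

  δ-bad : ∀ x p τ b → ¬ Good x → δ (just (p , τ , b)) (inj₂ x) ≡ nothing
  δ-bad x p τ b bad with good? x | L.≡-dec F._≟_ p (labels x)
  ... | yes good | _ = ⊥-elim (bad good)
  ... | no _     | _ = refl

  nonEmpty : Bool → List Profile → Bool
  nonEmpty b []      = b
  nonEmpty _ (_ ∷ _) = true

  foldl-encode : ∀ x w τ b → foldl δ (just ([] , τ , b)) (encode (x ∷ w)) ≡ foldl δ (δ (just (labels x , τ , b)) (inj₂ x)) (encode w)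
  foldl-encode x w τ b = trans (L.foldl-++ δ _ (block x) (encode w)) (cong (λ q → foldl δ q (encode w)) (read-block x τ b))

  run-encode : ∀ w τ b → All Good w → foldl δ (just ([] , τ , b)) (encode w) ≡ just ([] , foldl step τ w , nonEmpty b w)
  run-encode []      τ b []            = refl
  run-encode (x ∷ w) τ b (good ∷ goods) = begin
    foldl δ (just ([] , τ , b)) (encode (x ∷ w))                 ≡⟨ foldl-encode x w τ b ⟩
    foldl δ (δ (just (labels x , τ , b)) (inj₂ x)) (encode w)    ≡⟨ cong (λ q → foldl δ q (encode w)) (δ-good x τ b good) ⟩
    foldl δ (just ([] , step τ x , true)) (encode w)             ≡⟨ run-encode w (step τ x) true goods ⟩
    just ([] , foldl step (step τ x) w , nonEmpty true w)        ≡⟨ cong (λ b′ → just ([] , _ , b′)) (nonEmpty-true w) ⟩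
    just ([] , foldl step (step τ x) w , true)                   ∎
    where
    open ≡-Reasoning
    nonEmpty-true : ∀ w → nonEmpty true w ≡ true
    nonEmpty-true []      = refl
    nonEmpty-true (_ ∷ _) = refl

  after-block : ∀ x w τ b → Accepting (just ([] , τ , b)) (encode (x ∷ w)) →
                Accepting (δ (just (labels x , τ , b)) (inj₂ x)) (encode w)
  after-block x w τ b = subst (λ q → accepting q ≡ true) (foldl-encode x w τ b)

  accepted⇒good : ∀ w τ b → Accepting (just ([] , τ , b)) (encode w) → All Good w
  accepted⇒good []      τ b _        = []
  accepted⇒good (x ∷ w) τ b accepted with good? x
  ... | yes good = good ∷ accepted⇒good w (step τ x) true
    (subst (λ q → Accepting q (encode w)) (δ-good x τ b good) (after-block x w τ b accepted))
  ... | no bad   = ⊥-elim (dead-rejects (encode w)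
    (subst (λ q → Accepting q (encode w)) (δ-bad x (labels x) τ b bad) (after-block x w τ b accepted)))

  parse : ∀ u p τ b → Accepting (just (p , τ , b)) u →
          ∃ λ w → All Good w × L.map inj₁ p ++ u ≡ encode w
  parse []           []      τ b _ = [] , [] , refl
  parse []           (_ ∷ _) τ b ()
  parse (inj₁ a ∷ u) p τ b accepted with suc (length p) ≤? ℓ * k
  ... | no _  = ⊥-elim (dead-rejects u accepted)
  ... | yes _ with parse u (p ++ [ a ]) τ b accepted
  ...   | w , goods , u≡ = w , goods , trans (sym shift) u≡
    where
    shift : L.map inj₁ (p ++ [ a ]) ++ u ≡ L.map inj₁ p ++ inj₁ a ∷ u
    shift = trans (cong (_++ u) (L.map-++ inj₁ p [ a ])) (L.++-assoc (L.map inj₁ p) [ inj₁ a ] u)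
  parse (inj₂ x ∷ u) p τ b accepted with good? x | L.≡-dec F._≟_ p (labels x)
  ... | yes _    | no _ = ⊥-elim (dead-rejects u accepted)
  ... | no _     | _    = ⊥-elim (dead-rejects u accepted)
  ... | yes good | yes refl with parse u [] (step τ x) true accepted
  ...   | w , goods , u≡ = x ∷ w , good ∷ goods , (begin
    L.map inj₁ (labels x) ++ inj₂ x ∷ u              ≡⟨ cong (λ v → L.map inj₁ (labels x) ++ inj₂ x ∷ v) u≡ ⟩
    L.map inj₁ (labels x) ++ [ inj₂ x ] ++ encode w  ≡⟨ L.++-assoc (L.map inj₁ (labels x)) [ inj₂ x ] (encode w) ⟨
    (L.map inj₁ (labels x) ++ [ inj₂ x ]) ++ encode w ≡⟨ cong (_++ encode w) (block-labels x) ⟨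
    encode (x ∷ w)                                   ∎)
    where open ≡-Reasoning

  run-accepted : ∀ u → Accepts dfa u → Accepting q₀ u
  run-accepted u accepted = trans (sym (final-run u)) accepted

  accepted⇒encode : ∀ u → Accepts dfa u → ∃ λ w → All Good w × u ≡ encode w
  accepted⇒encode u accepted = parse u [] (wordType []) false (run-accepted u accepted)

  accepted-encode : ∀ w → Accepts dfa (encode w) → All Good w × 0 < length w × Sat (model 1 w) ψ (λ ())
  accepted-encode w accepted with accepted⇒good w _ _ (run-accepted (encode w) accepted)
  ... | goods with subst (λ q → accepting q ≡ true) (run-encode w (wordType []) false goods) (run-accepted (encode w) accepted)
  accepted-encode []      accepted | goods | ()
  accepted-encode (x ∷ w) accepted | goods | holds =
    goods , s≤s z≤n , to (eval-type ψ k qrψ≤k (model 1 (x ∷ w)) λ ())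
                         (from T-≡ (subst (λ τ → eval ψ k qrψ≤k τ ≡ true) (foldl-step [] (x ∷ w)) holds))

  accepts-encode : ∀ x w → All Good (x ∷ w) → Sat (model 1 (x ∷ w)) ψ (λ ()) → Accepts dfa (encode (x ∷ w))
  accepts-encode x w goods sat = begin
    DFA.final dfa (foldl (DFA.δ dfa) (DFA.init dfa) (encode (x ∷ w))) ≡⟨ final-run (encode (x ∷ w)) ⟩
    accepting (foldl δ q₀ (encode (x ∷ w)))                          ≡⟨ cong accepting (run-encode (x ∷ w) _ false goods) ⟩
    eval ψ k qrψ≤k (foldl step (wordType []) (x ∷ w))                ≡⟨ cong (eval ψ k qrψ≤k) (foldl-step [] (x ∷ w)) ⟩
    eval ψ k qrψ≤k (wordType (x ∷ w))                                ≡⟨ to T-≡ (from (eval-type ψ k qrψ≤k (model 1 (x ∷ w)) λ ()) sat) ⟩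
    true                                                             ∎
    where open ≡-Reasoning

module ExtendedRepresentation (ℓ k : ℕ) where
  open Counting ℓ
  open ThresholdInvariance ℓ
  open CanonicalModel ℓ k

  data ValueView (m : ℕ) : ℕ → Set where
    below  : ValueView m zero
    inside : (i : Fin m) → ValueView m (suc (toℕ i))
    above  : ∀ {d} → m < d → ValueView m d

  valueView : ∀ m d → ValueView m d
  valueView m zero    = below
  valueView m (suc d) with d N.<? m
  ... | yes d<m = subst (ValueView m ∘ suc) (F.toℕ-fromℕ< d<m) (inside (F.fromℕ< d<m))
  ... | no d≮m  = above (s≤s (N.≮⇒≥ d≮m))

  leaf : Node ℓ → Tree ℓ
  leaf (a , d) = node a d []

  nodesF-leaves : ∀ ns → nodesF (L.map leaf ns) ≡ ns
  nodesF-leaves []             = refl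
  nodesF-leaves ((a , d) ∷ ns) = cong ((a , d) ∷_) (nodesF-leaves ns)

  star : ∀ ns {n : Node ℓ} → n ∈ᴸ ns → Σ (Tree ℓ) λ t → nodes t ≡ ns
  star ((a , d) ∷ ns) _ = node a d (L.map leaf ns) , cong ((a , d) ∷_) (nodesF-leaves ns)

  tree-model : ∀ w → All Good w → 0 < length w → Σ (Tree ℓ) λ t → nodes t ≡ model 1 w
  tree-model (x ∷ w) (good ∷ _) _ =
    let a , 1≤m = proj₂ good in star (model 1 (x ∷ w)) (count⇒∈ _ a 1 (subst (1 ≤_) (sym (count-model 1 (x ∷ w) a F.zero)) 1≤m))

  module _ {t : Tree ℓ} {w} (t≡model : nodes t ≡ model 1 w) (goods : All Good w) where

    count-tree : ∀ a (i : Fin (length w)) → count a (suc (toℕ i)) (nodes t) ≡ multiplicity (L.lookup w i) a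
    count-tree a i = trans (cong (count a _) t≡model) (count-model 1 w a i)

    ∈-tree : ∀ a i → (a , suc (toℕ i)) ∈ᴸ nodes t ⇔ 1 ≤ multiplicity (L.lookup w i) a
    ∈-tree a i = mk⇔ (λ a∈ → subst (1 ≤_) (count-tree a i) (∈⇒count _ a _ a∈))
                     (λ 1≤m → count⇒∈ _ a _ (subst (1 ≤_) (sym (count-tree a i)) 1≤m))

    values-tree : DataValuesExactly t (length w)
    values-tree = in-range , occupied
      where
      in-range : ∀ a d → (a , d) ∈ᴸ nodes t → 1 ≤ d × d ≤ length w
      in-range a d a∈ with All.lookup (values-model 1 w) (subst ((a , d) ∈ᴸ_) t≡model a∈)
      ... | 1≤d , d<1+m = 1≤d , N.≤-pred d<1+m
      occupied : ∀ d → 1 ≤ d → d ≤ length w → ∃ λ a → (a , d) ∈ᴸ nodes t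
      occupied d 1≤d d≤m with valueView (length w) d
      ... | below     = ⊥-elim (N.<-irrefl refl 1≤d)
      ... | above m<d = ⊥-elim (N.<-irrefl refl (N.<-≤-trans m<d d≤m))
      ... | inside i  = let a , 1≤m = proj₂ (All.lookup goods (∈-lookup i)) in a , from (∈-tree a i) 1≤m

    extRep-model : IsExtRep k t w
    extRep-model = values-tree , λ i → let wf = proj₁ (All.lookup goods (∈-lookup i)) in
      ( (λ a a∈S → from (∈-tree a i) (proj₁ (wf a) a∈S))
      , (λ b b∉S b∈ → b∉S (proj₂ (wf b) (to (∈-tree b i) b∈))) )
      , (λ a → proj₁ (wf a) , λ a∉S → N.n<1⇒n≡0 (N.≰⇒> (a∉S ∘ proj₂ (wf a))))
      , (λ a → (λ _ _ → count-tree a i) , (λ m≡k → N.≤-reflexive (sym (trans (count-tree a i) m≡k))))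

  root : ∀ (t : Tree ℓ) → ∃ λ n → n ∈ᴸ nodes t
  root (node a d _) = (a , d) , here refl

  All-lookup⁻ : ∀ {P : Profile → Set} (w : List Profile) → (∀ i → P (L.lookup w i)) → All P w
  All-lookup⁻ {P} w P-at = All.tabulate λ x∈w → subst P (sym (lookup-index x∈w)) (P-at (Any.index x∈w))

  module _ {t : Tree ℓ} {w} (rep : IsExtRep k t w) where
    private
      in-range : ∀ a d → (a , d) ∈ᴸ nodes t → 1 ≤ d × d ≤ length w
      in-range = proj₁ (proj₁ rep)

      class : ∀ i → InClass t (suc (toℕ i)) (proj₁ (L.lookup w i))
      class i = proj₁ (proj₂ rep i)

      charFun : ∀ i → IsCharFun k (proj₂ (L.lookup w i)) (proj₁ (L.lookup w i))
      charFun i = proj₁ (proj₂ (proj₂ rep i))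

      countOK : ∀ i → CountOK k t (suc (toℕ i)) (proj₂ (L.lookup w i))
      countOK i = proj₂ (proj₂ (proj₂ rep i))

      ∈⇒∈S : ∀ i a → (a , suc (toℕ i)) ∈ᴸ nodes t → a ∈ proj₁ (L.lookup w i)
      ∈⇒∈S i a a∈ = decidable-stable (a Subset.∈? _) λ a∉S → proj₂ (class i) a a∉S a∈

    extRep-wellFormed : ∀ i → WellFormedLetter (L.lookup w i)
    extRep-wellFormed i a = proj₁ (charFun i a) , λ 1≤m →
      decidable-stable (a Subset.∈? _) λ a∉S → N.<-irrefl (sym (proj₂ (charFun i a) a∉S)) 1≤m

    extRep-good : All Good w
    extRep-good = All-lookup⁻ w λ i → extRep-wellFormed i ,
      let a , a∈ = proj₂ (proj₁ rep) (suc (toℕ i)) (s≤s z≤n) (F.toℕ<n i) in a , proj₁ (charFun i a) (∈⇒∈S i a a∈)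

    extRep-nonempty : 0 < length w
    extRep-nonempty = let (a , d) , root∈ = root t in N.<-≤-trans (proj₁ (in-range a d root∈)) (proj₂ (in-range a d root∈))

    count-inside : ∀ a i → let m = multiplicity (L.lookup w i) a in
                   count a (suc (toℕ i)) (nodes t) ≡ m ⊎ (k ≤ count a (suc (toℕ i)) (nodes t) × k ≤ m)
    count-inside a i with 1 ≤? multiplicity (L.lookup w i) a
    ... | no  m≱1 = inj₁ (trans (count≡0 _ a _ λ a∈ → m≱1 (proj₁ (charFun i a) (∈⇒∈S i a a∈)))
                                (sym (N.n<1⇒n≡0 (N.≰⇒> m≱1))))
    ... | yes 1≤m with multiplicity (L.lookup w i) a N.≟ k
    ...   | yes m≡k = inj₂ (proj₂ (countOK i a) m≡k , N.≤-reflexive (sym m≡k))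
    ...   | no  m≢k = inj₁ (proj₁ (countOK i a) 1≤m
                              (N.∸-monoˡ-≤ 1 (N.≤∧≢⇒< (F.toℕ≤pred[n] (proj₂ (L.lookup w i) a)) m≢k)))

    extRep-≈ : nodes t ≈[ k ] model 1 w
    extRep-≈ a d with valueView (length w) d
    ... | below = inj₁ (trans (count≡0 _ a 0 λ a∈ → N.<-irrefl refl (proj₁ (in-range a 0 a∈)))
                              (sym (count-model-outside 1 w a 0 λ (1≤0 , _) → N.<-irrefl refl 1≤0)))
    ... | above m<d = inj₁ (trans (count≡0 _ a d λ a∈ → N.<-irrefl refl (N.<-≤-trans m<d (proj₂ (in-range a d a∈))))
                                  (sym (count-model-outside 1 w a d λ (_ , d<1+m) → N.<-irrefl refl (N.<-≤-trans m<d (N.≤-pred d<1+m)))))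
    ... | inside i rewrite count-model 1 w a i = count-inside a i

lemma5p6 : ∀ {ℓ : ℕ} (k : ℕ) (ψ : Sentence ℓ) → qr ψ ≡ k → (∀ a → Occurs a ψ) →
    Σ (DFA (Letter ℓ k)) λ C →
    (∀ (u : List (Letter ℓ k)) → Accepts C u → ∃ λ w → WellFormed w × u ≡ encode w)
    × (∀ (t : Tree ℓ) → OrderedDataTree t → t ⊨ ψ →
    ∀ w → IsExtRep k t w → Accepts C (encode w))
    × (∀ w → WellFormed w → Accepts C (encode w) →
    Σ (Tree ℓ) λ t → OrderedDataTree t × t ⊨ ψ × IsExtRep k t w)
lemma5p6 {ℓ} k ψ qrψ≡k _ = dfa , encodes , accepts , models
  where
  open WordAutomaton ℓ k ψ (N.≤-reflexive qrψ≡k)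
  open ExtendedRepresentation ℓ k
  open ThresholdInvariance ℓ
  open CanonicalModel ℓ k

  encodes : ∀ u → Accepts dfa u → ∃ λ w → WellFormed w × u ≡ encode w
  encodes u accepted = let w , goods , u≡ = accepted⇒encode u accepted in w , proj₁ ∘ All.lookup goods ∘ ∈-lookup , u≡

  accepts : ∀ t → OrderedDataTree t → t ⊨ ψ → ∀ w → IsExtRep k t w → Accepts dfa (encode w)
  accepts t _ _    []      rep = ⊥-elim (N.<-irrefl refl (extRep-nonempty {w = []} rep))
  accepts t _ t⊨ψ (x ∷ w) rep = accepts-encode x w (extRep-good rep)
    (to (Sat-invariant (extRep-≈ rep) ψ (N.≤-reflexive qrψ≡k) (record { same-node = λ () ; same-position = λ () })) t⊨ψ)

  models : ∀ w → WellFormed w → Accepts dfa (encode w) → Σ (Tree ℓ) λ t → OrderedDataTree t × t ⊨ ψ × IsExtRep k t w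
  models w _ accepted =
    let goods , 0<m , sat = accepted-encode w accepted
        t , t≡model = tree-model w goods 0<m
    in t , (L.length w , 0<m , values-tree t≡model goods) , subst (λ ns → Sat ns ψ (λ ())) (sym t≡model) sat
         , extRep-model t≡model goods
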